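{- Let $\mathcal A=(A,w)$ be an internal-positive-weighted essential tree with leaf set $L(A)=[n]$, and for distinct $i,j\in[n]$ let $S_{i,j}=D_{\{i,j\}}(\mathcal A)$ be its $2$-weights. For distinct $a,b,c,d\in[n]$ let $$L_{a,b}=\Big\{x\in[n]\setminus\{c,d\}\ \Big|\ \text{either } S_{x,z}-S_{a,z}\text{ does not depend on } z\in\{b,c,d\}\setminus\{x\},\ \text{or } S_{x,z}-S_{b,z}\text{ does not depend on } z\in\{a,c,d\}\setminus\{x\}\Big\},$$ and define $L_{c,d}$ analogously with $\{a,b\}$ and $\{c,d\}$ exchanged. Let $a,b,c,d\in[n]$ be distinct. 1) If $\langle a,b\,|\,c,d\rangle$ holds, then $L_{a,b}\setminus\{a,b\}$ is the set of elements $x\in[n]\setminus\{a,b,c,d\}$ that cling to the path $p(a,b)$ as to $A|_{\{a,b,c,d\}}$, and $L_{c,d}\setminus\{c,d\}$ is the set of elements $x\in[n]\setminus\{a,b,c,d\}$ that cling to $p(c,d)$ as to $A|_{\{a,b,c,d\}}$. 2) $\langle a,b\,|\,c,d\rangle$ holds and the bridge of $(a,b,c,d)$ consists of exactly one edge if and only if (i) $S_{a,b}+S_{c,d}<S_{a,c}+S_{b,d}=S_{a,d}+S_{b,c}$ and (ii) $L_{a,b}\cup L_{c,d}=[n]$.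
   Context: A weighted tree $(T,w)$ is a finite tree with $w:E(T)\to\mathbb{R}$; $D_{\{i,j\}}$ is the total weight of the path $p(i,j)$ between $i$ and $j$. A node is a vertex of degree $>2$; the twig of a leaf $F$ is the path from $F$ to the node $N$ containing no node other than $N$; internal edges are edges not on any twig; internal-positive-weighted means all internal edges have positive weight; essential means no vertex of degree $2$. For $S\subseteq L(T)$, $T|_S$ is the minimal subtree of $T$ containing $S$. Two leaves $i,j$ of a tree are neighbours if the path between them contains exactly one node. $\langle a,b\,|\,c,d\rangle$ holds if in $A|_{\{a,b,c,d\}}$ the leaves $a,b$ are neighbours, $c,d$ are neighbours, and $a,c$ are not neighbours; then the stalk $s_{a,b}$ is the unique node on the path from $a$ to $b$ in $A|_{\{a,b,c,d\}}$ (similarly $s_{c,d}$), and the bridge of $(a,b,c,d)$ is the path from $s_{a,b}$ to $s_{c,d}$ in $A|_{\{a,b,c,d\}}$. If $T'$ is a subtree of $T$, $S$ a subtree of $T'$ and $x\in L(T)\setminus L(T')$, then $x$ clings to $S$ as to $T'$ if the minimal subtree of $T$ containing $S$ and $x$ has no edge in common with the edges of $T'$ not belonging to $S$. -}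

module Defs where

open import Level using (0ℓ)
open import Data.Nat using (ℕ) renaming (_≤_ to _≤ℕ_)
open import Data.Fin using (Fin)
open import Data.List using (List; []; _∷_; length)
open import Data.List.Membership.Propositional using (_∈_)
open import Data.List.Relation.Unary.Unique.Propositional using (Unique)
open import Data.Product using (Σ; _×_; _,_; proj₁)
open import Data.Sum using (_⊎_)
open import Relation.Nullary using (¬_)
open import Relation.Binary.PropositionalEquality using (_≡_; _≢_)
open import Relation.Binary.Core using (Rel)
open import Relation.Binary.Structures using (IsStrictTotalOrder)
open import Algebra.Core using (Op₁; Op₂)
open import Algebra.Structures using (IsCommutativeRing)

record RealField : Set₁ where
  infixl 7 _*_
  infixl 6 _+_ _-_
  infix  4 _≈_ _<_ _≤_
  field
    Carrier : Set
    _≈_     : Rel Carrier 0ℓ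
    _+_ _*_ : Op₂ Carrier
    -_      : Op₁ Carrier
    0# 1#   : Carrier
    _<_     : Rel Carrier 0ℓ
    isCommutativeRing    : IsCommutativeRing _≈_ _+_ _*_ -_ 0# 1#
    <-isStrictTotalOrder : IsStrictTotalOrder _≈_ _<_
    0<1     : 0# < 1#
    +-mono-< : ∀ {x y} z → x < y → x + z < y + z
    *-pos   : ∀ {x y} → 0# < x → 0# < y → 0# < x * y
    inverse : ∀ x → ¬ (x ≈ 0#) → Σ Carrier (λ y → x * y ≈ 1#)

  _-_ : Op₂ Carrier
  x - y = x + (- y)

  _≤_ : Rel Carrier 0ℓ
  x ≤ y = x < y ⊎ x ≈ y

  field
    complete : (P : Carrier → Set) → Σ Carrier P →
               Σ Carrier (λ b → ∀ x → P x → x ≤ b) →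
               Σ Carrier (λ s → (∀ x → P x → x ≤ s) ×
                                (∀ b → (∀ x → P x → x ≤ b) → s ≤ b))

module _ {m : ℕ} (Adj : Fin m → Fin m → Set) where

  data IsWalk : Fin m → Fin m → List (Fin m) → Set where
    single : ∀ {u} → IsWalk u u (u ∷ [])
    step   : ∀ {u x v xs} → Adj u x → IsWalk x v xs → IsWalk u v (u ∷ xs)

  IsPath : Fin m → Fin m → List (Fin m) → Set
  IsPath u v ps = IsWalk u v ps × Unique ps

  HasCycle : Set
  HasCycle = Σ (Fin m) λ u → Σ (Fin m) λ v → Σ (List (Fin m)) λ ps →
             IsPath u v ps × 3 ≤ℕ length ps × Adj v u

data Consec {A : Set} : List A → A → A → Set where
  here  : ∀ {x y r} → Consec (x ∷ y ∷ r) x y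
  there : ∀ {z xs x y} → Consec xs x y → Consec (z ∷ xs) x y

EdgeOn : {A : Set} → List A → A → A → Set
EdgeOn ps x y = Consec ps x y ⊎ Consec ps y x

record WTree (ℝ : RealField) (m : ℕ) : Set₁ where
  open RealField ℝ
  field
    Adj        : Fin m → Fin m → Set
    Adj-sym    : ∀ {u v} → Adj u v → Adj v u
    Adj-irrefl : ∀ {u} → ¬ Adj u u
    w          : Fin m → Fin m → Carrier
    w-sym      : ∀ u v → w u v ≈ w v u
    path       : ∀ u v → Σ (List (Fin m)) (IsPath Adj u v)
    acyclic    : ¬ HasCycle Adj

module TreeDefs {ℝ : RealField} {m : ℕ} (T : WTree ℝ m) where
  open RealField ℝ
  open WTree T

  V : Set
  V = Fin m

  p : V → V → List V
  p u v = proj₁ (path u v)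

  weight : List V → Carrier
  weight []            = 0#
  weight (x ∷ [])      = 0#
  weight (x ∷ y ∷ r)   = w x y + weight (y ∷ r)

  D : V → V → Carrier
  D u v = weight (p u v)

  IsLeaf : V → Set
  IsLeaf v = Σ V λ u → Adj v u × (∀ u' → Adj v u' → u' ≡ u)

  IsNode : V → Set
  IsNode v = Σ V λ u₁ → Σ V λ u₂ → Σ V λ u₃ →
             u₁ ≢ u₂ × u₁ ≢ u₃ × u₂ ≢ u₃ × Adj v u₁ × Adj v u₂ × Adj v u₃

  Degree2 : V → Set
  Degree2 v = Σ V λ u₁ → Σ V λ u₂ → u₁ ≢ u₂ × Adj v u₁ × Adj v u₂ ×
              (∀ u → Adj v u → u ≡ u₁ ⊎ u ≡ u₂)

  Essential : Set
  Essential = ∀ v → ¬ Degree2 v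

  OnTwig : V → V → Set
  OnTwig x y = Σ V λ F → Σ V λ N → IsLeaf F × IsNode N ×
               (∀ z → z ∈ p F N → IsNode z → z ≡ N) × EdgeOn (p F N) x y

  InternalPositive : Set
  InternalPositive = ∀ x y → Adj x y → ¬ OnTwig x y → 0# < w x y

  -- minimal subtree T|_U containing a vertex set U: vertices and edges
  SubV : (V → Set) → V → Set
  SubV U x = Σ V λ u → Σ V λ v → U u × U v × x ∈ p u v

  SubE : (V → Set) → V → V → Set
  SubE U x y = Σ V λ u → Σ V λ v → U u × U v × EdgeOn (p u v) x y

  SubNode : (V → Set) → V → Set
  SubNode U x = SubV U x × (Σ V λ y₁ → Σ V λ y₂ → Σ V λ y₃ →
                y₁ ≢ y₂ × y₁ ≢ y₃ × y₂ ≢ y₃ ×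
                SubE U x y₁ × SubE U x y₂ × SubE U x y₃)

  Neighbours : (V → Set) → V → V → Set
  Neighbours U i j = Σ V λ s → s ∈ p i j × SubNode U s ×
                     (∀ s' → s' ∈ p i j → SubNode U s' → s' ≡ s)

module LeafDefs {ℝ : RealField} {m n : ℕ} (T : WTree ℝ m) (leaf : Fin n → Fin m) where
  open RealField ℝ
  open WTree T
  open TreeDefs T

  -- L(A) = [n] via the labelling leaf
  LeafSet : Set
  LeafSet = (∀ i j → leaf i ≡ leaf j → i ≡ j) ×
            (∀ i → IsLeaf (leaf i)) ×
            (∀ v → IsLeaf v → Σ (Fin n) λ i → leaf i ≡ v)

  S : Fin n → Fin n → Carrier
  S i j = D (leaf i) (leaf j)

  Quad : Fin n → Fin n → Fin n → Fin n → V → Set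
  Quad a b c d v = v ≡ leaf a ⊎ v ≡ leaf b ⊎ v ≡ leaf c ⊎ v ≡ leaf d

  Split : Fin n → Fin n → Fin n → Fin n → Set
  Split a b c d = Neighbours Q (leaf a) (leaf b) × Neighbours Q (leaf c) (leaf d) ×
                  ¬ Neighbours Q (leaf a) (leaf c)
    where Q = Quad a b c d

  Stalk : Fin n → Fin n → Fin n → Fin n → Fin n → Fin n → V → Set
  Stalk a b c d i j s = s ∈ p (leaf i) (leaf j) × SubNode (Quad a b c d) s

  BridgeOneEdge : Fin n → Fin n → Fin n → Fin n → Set
  BridgeOneEdge a b c d = Σ V λ s → Σ V λ t →
    Stalk a b c d a b s × Stalk a b c d c d t × length (p s t) ≡ 2

  Clings : Fin n → Fin n → Fin n → Fin n → Fin n → Set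
  Clings a b c d x = ∀ y z → SubE U y z → SubE (Quad a b c d) y z →
                     EdgeOn (p (leaf a) (leaf b)) y z
    where U : V → Set
          U v = v ∈ p (leaf a) (leaf b) ⊎ v ≡ leaf x

  In3 : Fin n → Fin n → Fin n → Fin n → Fin n → Set
  In3 z₁ z₂ z₃ x z = (z ≡ z₁ ⊎ z ≡ z₂ ⊎ z ≡ z₃) × z ≢ x

  ConstDiff : Fin n → Fin n → Fin n → Fin n → Fin n → Set
  ConstDiff x y z₁ z₂ z₃ = ∀ z z' → In3 z₁ z₂ z₃ x z → In3 z₁ z₂ z₃ x z' →
                           S x z - S y z ≈ S x z' - S y z'

  InL : Fin n → Fin n → Fin n → Fin n → Fin n → Set
  InL a b c d x = x ≢ c × x ≢ d × (ConstDiff x a b c d ⊎ ConstDiff x b a c d)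

-- If the quartet is resolved as ⟨a,b|c,d⟩ with stalks s and t, splitting the paths at s and t gives
-- S a c + S b d = S a b + S c d + 2 D(s,t) = S a d + S b c, while for a star all three sums agree;
-- D(s,t) > 0 because internal edges are positive and s, t are not leaves.  A leaf x attaches to p(a,b)
-- at the median r of x, a, b.  If the path from x to r uses no edge of A|{a,b,c,d}, every path from x
-- to the quartet passes through r, so S x z − S a z (or S x z − S b z) is the same for all z.  If it
-- does meet the quartet's subtree earlier, x hangs off the path from a stalk s to some c at a vertex
-- g ≠ s, and the differences for z = b and z = c differ by 2 D(s,g) > 0.  For part 2, a one-edge bridge
-- forces every leaf to attach on the side of s or of t, so L a b ∪ L c d is everything; along a longer
-- bridge an interior vertex has, the tree being essential, a third neighbour, and a leaf behind it
-- attaches strictly inside the bridge, which keeps it out of both sets.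

module Submission where

open import Defs
open import Level using (0ℓ)
open import Algebra.Bundles using (CommutativeRing)
import Algebra.Solver.Ring as RingSolver
import Algebra.Solver.Ring.AlmostCommutativeRing as AlmostCommutativeRing
open import Data.Empty using (⊥; ⊥-elim)
open import Data.List using (List; []; _∷_; _++_; reverse; _∷ʳ_; [_]; length; allFin)
open import Data.List.Membership.Propositional using (_∈_; _∉_)
open import Data.List.Membership.Propositional.Properties using (∈-++⁺ˡ; ∈-++⁺ʳ; ∈-++⁻; ∈-∃++; ∈-allFin)
open import Data.List.Properties using (unfold-reverse; reverse-++; ++-assoc; length-++)
open import Data.List.Relation.Unary.All using (All; []; _∷_)
import Data.List.Relation.Unary.All.Properties as All
open import Data.List.Relation.Unary.Any using (here; there)
import Data.List.Relation.Unary.Any.Properties as Any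
open import Data.List.Relation.Unary.AllPairs using ([]; _∷_)
open import Data.List.Relation.Unary.Unique.Propositional using (Unique)
import Data.List.Relation.Unary.Unique.Propositional.Properties as Uniqueₚ
open import Data.Maybe using (nothing)
open import Data.Nat using (ℕ; _≤?_; s≤s; z≤n) renaming (_≤_ to _≤ℕ_; _<_ to _<ℕ_)
open import Data.Nat.Properties using (≤-refl; ≤-trans; <⇒≤; ≰⇒>; +-monoʳ-<; <⇒≱)
open import Data.Product using (Σ; _×_; _,_; proj₁; proj₂; swap)
open import Data.Sum using (_⊎_; inj₁; inj₂; map; map₂; fromInj₂) renaming ([_,_] to [_,_]′)
open import Relation.Binary.PropositionalEquality using (_≡_; _≢_; refl; sym; cong; subst; module ≡-Reasoning; trans; subst₂; ≢-sym)
open import Relation.Binary.Structures using (IsStrictTotalOrder)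
open import Relation.Nullary using (¬_; yes; no; Dec)
open import Relation.Unary using (Decidable)
import Relation.Binary.Reasoning.Setoid as SetoidReasoning
open import Data.Fin using (Fin)
open import Data.Fin.Properties using (_≟_)
import Data.List.Membership.DecPropositional as DecMembership
import Data.Sum
open import Function using (_∘_)
open import Function.Bundles using (_⇔_; mk⇔; Equivalence)
import Data.Nat as ℕ

module _ {X : Set} where

  ∉⇒All≢ : ∀ {x : X} {xs} → x ∉ xs → All (x ≢_) xs
  ∉⇒All≢ {xs = []}     _   = []
  ∉⇒All≢ {xs = _ ∷ xs} x∉ = (λ e → x∉ (here e)) ∷ ∉⇒All≢ (λ i → x∉ (there i))

  All≢⇒∉ : ∀ {x : X} {xs} → All (x ≢_) xs → x ∉ xs
  All≢⇒∉ (x≢y ∷ _)  (here e)  = x≢y e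
  All≢⇒∉ (_ ∷ x≢ys) (there i) = All≢⇒∉ x≢ys i

  Unique-++⁻ˡ : ∀ (xs : List X) {ys} → Unique (xs ++ ys) → Unique xs
  Unique-++⁻ˡ []       _          = []
  Unique-++⁻ˡ (x ∷ xs) (x≢ ∷ u) = All.++⁻ˡ xs x≢ ∷ Unique-++⁻ˡ xs u

  Unique-++⁻ʳ : ∀ (xs : List X) {ys} → Unique (xs ++ ys) → Unique ys
  Unique-++⁻ʳ []       u       = u
  Unique-++⁻ʳ (_ ∷ xs) (_ ∷ u) = Unique-++⁻ʳ xs u

  Unique-++⇒Disjoint : ∀ (xs : List X) {ys z} → Unique (xs ++ ys) → z ∈ xs → z ∈ ys → ⊥
  Unique-++⇒Disjoint (x ∷ xs) (x≢ ∷ _) (here refl) z∈ys = All≢⇒∉ (All.++⁻ʳ xs x≢) z∈ys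
  Unique-++⇒Disjoint (x ∷ xs) (_ ∷ u)  (there z∈xs) z∈ys = Unique-++⇒Disjoint xs u z∈xs z∈ys

  Unique-reverse⁺ : ∀ (xs : List X) → Unique xs → Unique (reverse xs)
  Unique-reverse⁺ []       u = u
  Unique-reverse⁺ (x ∷ xs) (x≢ ∷ u) rewrite unfold-reverse x xs =
    Uniqueₚ.++⁺ (Unique-reverse⁺ xs u) ([] ∷ [])
      λ { (i , here refl) → All≢⇒∉ x≢ (Any.reverse⁻ i) }

  first-satisfying : (P : X → Set) → Decidable P → ∀ xs {y} → y ∈ xs → P y →
                     Σ (List X) λ pre → Σ X λ z → Σ (List X) λ post →
                     xs ≡ pre ++ z ∷ post × P z × (∀ {q} → q ∈ pre → ¬ P q)
  first-satisfying P P? (x ∷ xs) y∈ Py with P? x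
  ... | yes Px = [] , x , xs , refl , Px , λ ()
  first-satisfying P P? (x ∷ xs) (here refl) Py | no ¬Px = ⊥-elim (¬Px Py)
  first-satisfying P P? (x ∷ xs) (there y∈) Py | no ¬Px with first-satisfying P P? xs y∈ Py
  ... | pre , z , post , refl , Pz , before = x ∷ pre , z , post , refl , Pz ,
        λ { (here refl) → ¬Px ; (there k) → before k }

  Consec⇒split : ∀ {xs : List X} {x y} → Consec xs x y →
                 Σ (List X) λ pre → Σ (List X) λ post → xs ≡ pre ++ x ∷ y ∷ post
  Consec⇒split here = [] , _ , refl
  Consec⇒split {z ∷ _} (there c) with Consec⇒split c
  ... | pre , post , refl = z ∷ pre , post , refl

  Consec-middle : ∀ (pre : List X) {x y post} → Consec (pre ++ x ∷ y ∷ post) x y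
  Consec-middle []        = here
  Consec-middle (_ ∷ pre) = there (Consec-middle pre)

  Consec-++⁺ˡ : ∀ {xs : List X} ys {x y} → Consec xs x y → Consec (xs ++ ys) x y
  Consec-++⁺ˡ ys here      = here
  Consec-++⁺ˡ ys (there c) = there (Consec-++⁺ˡ ys c)

  Consec-++⁺ʳ : ∀ (xs : List X) {ys x y} → Consec ys x y → Consec (xs ++ ys) x y
  Consec-++⁺ʳ []       c = c
  Consec-++⁺ʳ (_ ∷ xs) c = there (Consec-++⁺ʳ xs c)

  Consec-++⁻ : ∀ (pre : List X) {z post x y} → Consec (pre ++ z ∷ post) x y →
               Consec (pre ++ [ z ]) x y ⊎ Consec (z ∷ post) x y
  Consec-++⁻ []            c         = inj₂ c
  Consec-++⁻ (_ ∷ [])      here      = inj₁ here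
  Consec-++⁻ (_ ∷ _ ∷ pre) here      = inj₁ here
  Consec-++⁻ (_ ∷ pre)     (there c) with Consec-++⁻ pre c
  ... | inj₁ c' = inj₁ (there c')
  ... | inj₂ c' = inj₂ c'

  Consec-reverse : ∀ {xs : List X} {x y} → Consec xs x y → Consec (reverse xs) y x
  Consec-reverse {x = x} {y} c with Consec⇒split c
  ... | pre , post , refl = subst (λ q → Consec q y x) (sym reverse-split) (Consec-middle (reverse post))
    where
    reverse-split : reverse (pre ++ x ∷ y ∷ post) ≡ reverse post ++ y ∷ x ∷ reverse pre
    reverse-split = begin
      reverse (pre ++ x ∷ y ∷ post)                   ≡⟨ reverse-++ pre (x ∷ y ∷ post) ⟩
      reverse (x ∷ y ∷ post) ++ reverse pre           ≡⟨ cong (_++ reverse pre) (unfold-reverse x (y ∷ post)) ⟩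
      (reverse (y ∷ post) ∷ʳ x) ++ reverse pre        ≡⟨ cong (λ q → (q ∷ʳ x) ++ reverse pre) (unfold-reverse y post) ⟩
      ((reverse post ∷ʳ y) ∷ʳ x) ++ reverse pre       ≡⟨ cong (_++ reverse pre) (++-assoc (reverse post) [ y ] [ x ]) ⟩
      (reverse post ++ y ∷ x ∷ []) ++ reverse pre     ≡⟨ ++-assoc (reverse post) (y ∷ x ∷ []) (reverse pre) ⟩
      reverse post ++ y ∷ x ∷ reverse pre             ∎
      where open ≡-Reasoning

  prefix-keeps-head : ∀ (pre : List X) {q post y k r} → pre ++ q ∷ post ≡ y ∷ k ∷ r → q ≢ y →
                      Σ (List X) λ r' → pre ++ [ q ] ≡ y ∷ k ∷ r'
  prefix-keeps-head []            refl q≢y = ⊥-elim (q≢y refl)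
  prefix-keeps-head (_ ∷ [])      refl _   = [] , refl
  prefix-keeps-head (_ ∷ _ ∷ pre) {q} refl _ = pre ++ [ q ] , refl

  argmax : (f : X → ℕ) {P : X → Set} → Decidable P → ∀ {x₀} → P x₀ → (xs : List X) →
           Σ X λ z → P z × (∀ {z'} → z' ∈ xs → P z' → f z' ≤ℕ f z)
  argmax f P? {x₀} Px₀ [] = x₀ , Px₀ , λ ()
  argmax f P? Px₀ (x ∷ xs) with argmax f P? Px₀ xs
  ... | z , Pz , z-max with P? x
  ...   | no ¬Px = z , Pz , λ { (here refl) Px → ⊥-elim (¬Px Px) ; (there i) → z-max i }
  ...   | yes Px with f x ≤? f z
  ...     | yes fx≤fz = z , Pz , λ { (here refl) _ → fx≤fz ; (there i) → z-max i }
  ...     | no fx≰fz = x , Px , λ { (here refl) _ → ≤-refl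
                                  ; (there i) Pz' → ≤-trans (z-max i Pz') (<⇒≤ (≰⇒> fx≰fz)) }

  extension-keeps-head : ∀ (pre : List X) {l post y k r} → pre ++ [ l ] ≡ y ∷ k ∷ r →
                         Σ (List X) λ r' → pre ++ l ∷ post ≡ y ∷ k ∷ r'
  extension-keeps-head (_ ∷ [])      {post = post} refl = post , refl
  extension-keeps-head (_ ∷ _ ∷ pre) {l} {post} refl = pre ++ l ∷ post , refl

module RealFieldProperties (ℝ : RealField) where
  open RealField ℝ public

  commutativeRing : CommutativeRing 0ℓ 0ℓ
  commutativeRing = record { isCommutativeRing = isCommutativeRing }

  open CommutativeRing commutativeRing public
    using (setoid; +-cong; +-congˡ; +-congʳ; +-identityˡ; +-identityʳ; +-comm; +-assoc; -‿inverseˡ; -‿inverseʳ)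
    renaming (refl to ≈-refl; sym to ≈-sym; trans to ≈-trans)
  open IsStrictTotalOrder <-isStrictTotalOrder public
    using (irrefl; <-respʳ-≈; <-respˡ-≈) renaming (trans to <-trans)

  private
    almostCommutativeRing : AlmostCommutativeRing.AlmostCommutativeRing 0ℓ 0ℓ
    almostCommutativeRing = AlmostCommutativeRing.fromCommutativeRing commutativeRing
  open RingSolver (AlmostCommutativeRing.AlmostCommutativeRing.rawRing almostCommutativeRing)
    almostCommutativeRing (AlmostCommutativeRing.-raw-almostCommutative⟶ almostCommutativeRing)
    (λ _ _ → nothing) public
    using (solve; _:+_; _:-_; _:=_)

  x-y+y≈x : ∀ x y → (x - y) + y ≈ x
  x-y+y≈x x y = ≈-trans (+-assoc x (- y) y) (≈-trans (+-congˡ (-‿inverseˡ y)) (+-identityʳ x))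

  x+y-y≈x : ∀ x y → (x + y) - y ≈ x
  x+y-y≈x x y = ≈-trans (+-assoc x y (- y)) (≈-trans (+-congˡ (-‿inverseʳ y)) (+-identityʳ x))

  <-resp-≈ : ∀ {x x' y y'} → x ≈ x' → y ≈ y' → x < y → x' < y'
  <-resp-≈ x≈x' y≈y' x<y = <-respˡ-≈ x≈x' (<-respʳ-≈ y≈y' x<y)

  <-asym : ∀ {x y} → x < y → ¬ (y < x)
  <-asym x<y y<x = irrefl ≈-refl (<-trans x<y y<x)

  x<x+y : ∀ {x y} → 0# < y → x < x + y
  x<x+y {x} {y} 0<y = <-resp-≈ (+-identityˡ x) (+-comm y x) (+-mono-< x 0<y)

  +-pos : ∀ {x y} → 0# < x → 0# < y → 0# < x + y
  +-pos 0<x 0<y = <-trans 0<x (x<x+y 0<y)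

  +-nonneg-pos : ∀ {x y} → 0# ≤ x → 0# < y → 0# < x + y
  +-nonneg-pos (inj₁ 0<x)  0<y = +-pos 0<x 0<y
  +-nonneg-pos {y = y} (inj₂ 0≈x) 0<y =
    <-respʳ-≈ (≈-trans (≈-sym (+-identityˡ y)) (+-congʳ 0≈x)) 0<y

  x≈y+z⇒x≉y : ∀ {x y z} → 0# < z → x ≈ y + z → ¬ (x ≈ y)
  x≈y+z⇒x≉y 0<z x≈y+z x≈y = irrefl (≈-trans (≈-sym x≈y) x≈y+z) (x<x+y 0<z)

  -- the solver cannot cancel (it has no zero test on coefficients), so differences are
  -- compared through cross sums
  x-y≈z-w⇒x+w≈z+y : ∀ {x y z w} → x - y ≈ z - w → x + w ≈ z + y
  x-y≈z-w⇒x+w≈z+y {x} {y} {z} {w} eq = begin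
    x + w               ≈⟨ +-congʳ (x-y+y≈x x y) ⟨
    ((x - y) + y) + w   ≈⟨ +-congʳ (+-congʳ eq) ⟩
    ((z - w) + y) + w   ≈⟨ solve 3 (λ e y w → (e :+ y) :+ w := (e :+ w) :+ y) ≈-refl (z - w) y w ⟩
    ((z - w) + w) + y   ≈⟨ +-congʳ (x-y+y≈x z w) ⟩
    z + y               ∎
    where open SetoidReasoning setoid

  x+w≈z+y⇒x-y≈z-w : ∀ {x y z w} → x + w ≈ z + y → x - y ≈ z - w
  x+w≈z+y⇒x-y≈z-w {x} {y} {z} {w} eq = begin
    x - y               ≈⟨ +-congʳ (x+y-y≈x x w) ⟨
    ((x + w) - w) - y   ≈⟨ +-congʳ (+-congʳ eq) ⟩
    ((z + y) - w) - y   ≈⟨ +-congʳ (solve 3 (λ z y w → (z :+ y) :- w := (z :- w) :+ y) ≈-refl z y w) ⟩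
    ((z - w) + y) - y   ≈⟨ x+y-y≈x (z - w) y ⟩
    z - w               ∎
    where open SetoidReasoning setoid

-- Paths in trees

module Walks {m : ℕ} {Adj : Fin m → Fin m → Set} where

  open DecMembership (_≟_ {m}) using (_∈?_)

  Walk : Fin m → Fin m → List (Fin m) → Set
  Walk = IsWalk Adj

  walk-head : ∀ {u v xs} → Walk u v xs → Σ (List (Fin m)) λ zs → xs ≡ u ∷ zs
  walk-head single     = _ , refl
  walk-head (step _ _) = _ , refl

  walk-last : ∀ {u v xs} → Walk u v xs → Σ (List (Fin m)) λ zs → xs ≡ zs ++ [ v ]
  walk-last single = [] , refl
  walk-last {u} (step _ w) with walk-last w
  ... | zs , refl = u ∷ zs , refl

  walk-target∈ : ∀ {u v xs} → Walk u v xs → v ∈ xs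
  walk-target∈ single     = here refl
  walk-target∈ (step _ w) = there (walk-target∈ w)

  walk-++ : ∀ {u v w ys zs} → Walk u v ys → Walk v w (v ∷ zs) → Walk u w (ys ++ zs)
  walk-++ single       w₂ = w₂
  walk-++ (step uk w₁) w₂ = step uk (walk-++ w₁ w₂)

  walk-reverse : (∀ {u v} → Adj u v → Adj v u) → ∀ {u v xs} → Walk u v xs → Walk v u (reverse xs)
  walk-reverse sym single = single
  walk-reverse sym {u} (step {xs = xs} uk w) rewrite unfold-reverse u xs =
    walk-++ (walk-reverse sym w) (step (sym uk) single)

  walk-prefix : ∀ {u v z} pre {post} → Walk u v (pre ++ z ∷ post) → Walk u z (pre ++ [ z ])
  walk-prefix [] w with walk-head w
  ... | _ , refl = single
  walk-prefix (_ ∷ []) (step uk w) with walk-head w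
  ... | _ , refl = step uk single
  walk-prefix (_ ∷ y ∷ pre) (step uk w) = step uk (walk-prefix (y ∷ pre) w)

  walk-suffix : ∀ {u v z} pre {post} → Walk u v (pre ++ z ∷ post) → Walk z v (z ∷ post)
  walk-suffix [] single = single
  walk-suffix [] (step uk w) = step uk w
  walk-suffix (_ ∷ []) (step _ w) with walk-head w
  ... | _ , refl = w
  walk-suffix (_ ∷ y ∷ pre) (step _ w) = walk-suffix (y ∷ pre) w

  walk-Consec⇒Adj : ∀ {u v xs x y} → Walk u v xs → Consec xs x y → Adj x y
  walk-Consec⇒Adj (step uk w) here with walk-head w
  ... | _ , refl = uk
  walk-Consec⇒Adj (step _ w) (there c) = walk-Consec⇒Adj w c

  loop-erase : ∀ {u v ws} → Walk u v ws →
               Σ (List (Fin m)) λ ps → IsPath Adj u v ps × (∀ {z} → z ∈ ps → z ∈ ws)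
  loop-erase single = _ , (single , [] ∷ []) , λ i → i
  loop-erase {u} (step uk w) with loop-erase w
  ... | ps , (pw , pu) , ps⊆ with u ∈? ps
  ... | yes u∈ps with ∈-∃++ u∈ps
  ...   | pre , post , refl =
          u ∷ post , (walk-suffix pre pw , Unique-++⁻ʳ pre pu) ,
          λ { (here refl) → here refl ; (there j) → there (ps⊆ (∈-++⁺ʳ pre (there j))) }
  loop-erase {u} (step uk w) | ps , (pw , pu) , ps⊆ | no u∉ps =
    u ∷ ps , (step uk pw , ∉⇒All≢ u∉ps ∷ pu) , λ { (here refl) → here refl ; (there j) → there (ps⊆ j) }

module TreePaths {ℝ : RealField} {m : ℕ} (T : WTree ℝ m) where
  open WTree T
  open TreeDefs T
  open Walks {m} {Adj}
  open DecMembership (_≟_ {m}) using (_∈?_)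

  private
    joined-walks⇒path : ∀ {x y v xs ys} → Walk x v xs → Walk y v ys →
                        Σ (List V) λ π → IsPath Adj x y π × (∀ {z} → z ∈ π → z ∈ xs ⊎ z ∈ ys)
    joined-walks⇒path {y = y} {v} w w' with walk-head (walk-reverse Adj-sym w')
    ... | zs , back≡ with loop-erase (walk-++ w (subst (Walk v y) back≡ (walk-reverse Adj-sym w')))
    ... | π , π-path , π⊆ = π , π-path , λ z∈ →
          map₂ (λ z∈zs → Any.reverse⁻ (subst (_ ∈_) (sym back≡) (there z∈zs))) (∈-++⁻ _ (π⊆ z∈))

  -- two different first steps out of u would close up, through the common end, into a cycle at u
  path-unique : ∀ {u v ps qs} → IsPath Adj u v ps → IsPath Adj u v qs → ps ≡ qs
  path-unique (single , _) (single , _) = refl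
  path-unique (single , _) (step _ w , u∉ ∷ _) = ⊥-elim (All≢⇒∉ u∉ (walk-target∈ w))
  path-unique (step _ w , u∉ ∷ _) (single , _) = ⊥-elim (All≢⇒∉ u∉ (walk-target∈ w))
  path-unique {u} (step {x = x} ux w , u∉ws ∷ ws!) (step {x = y} uy w' , u∉ws' ∷ ws'!) with x ≟ y
  ... | yes refl = cong (u ∷_) (path-unique (w , ws!) (w' , ws'!))
  ... | no x≢y with joined-walks⇒path w w'
  ...   | π , (π-walk , π!) , π⊆ =
          ⊥-elim (acyclic (u , y , u ∷ π , (step ux π-walk , ∉⇒All≢ u∉π ∷ π!) , length≥3 π-walk , Adj-sym uy))
    where
    u∉π : u ∉ π
    u∉π z∈ = [ All≢⇒∉ u∉ws , All≢⇒∉ u∉ws' ]′ (π⊆ z∈)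
    length≥3 : ∀ {ps} → Walk x y ps → 3 ≤ℕ length (u ∷ ps)
    length≥3 single              = ⊥-elim (x≢y refl)
    length≥3 (step _ single)     = s≤s (s≤s (s≤s z≤n))
    length≥3 (step _ (step _ _)) = s≤s (s≤s (s≤s z≤n))

  p-isPath : ∀ u v → IsPath Adj u v (p u v)
  p-isPath u v = proj₂ (path u v)

  p-walk : ∀ u v → Walk u v (p u v)
  p-walk u v = proj₁ (p-isPath u v)

  p-unique : ∀ u v → Unique (p u v)
  p-unique u v = proj₂ (p-isPath u v)

  isPath⇒≡p : ∀ {u v ps} → IsPath Adj u v ps → ps ≡ p u v
  isPath⇒≡p π = path-unique π (p-isPath _ _)

  source∈p : ∀ u v → u ∈ p u v
  source∈p u v with walk-head (p-walk u v)
  ... | _ , e = subst (u ∈_) (sym e) (here refl)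

  target∈p : ∀ u v → v ∈ p u v
  target∈p u v = walk-target∈ (p-walk u v)

  p-refl : ∀ u → p u u ≡ [ u ]
  p-refl u = sym (isPath⇒≡p (single , [] ∷ []))

  p-reverse : ∀ u v → p v u ≡ reverse (p u v)
  p-reverse u v = sym (isPath⇒≡p (walk-reverse Adj-sym (p-walk u v) , Unique-reverse⁺ _ (p-unique u v)))

  ∈p-sym : ∀ {u v z} → z ∈ p u v → z ∈ p v u
  ∈p-sym {u} {v} i = subst (_ ∈_) (sym (p-reverse u v)) (Any.reverse⁺ i)

  Adj⇒p : ∀ {u v} → Adj u v → p u v ≡ u ∷ v ∷ []
  Adj⇒p {u} uv = sym (isPath⇒≡p (step uv single , ((λ e → Adj-irrefl (subst (Adj u) (sym e) uv)) ∷ []) ∷ [] ∷ []))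

  record Splitting (u z v : V) : Set where
    field
      pre post : List V
      whole : p u v ≡ pre ++ z ∷ post
      left  : p u z ≡ pre ++ [ z ]
      right : p z v ≡ z ∷ post

  splitting : ∀ {u z v} pre post → p u v ≡ pre ++ z ∷ post → Splitting u z v
  splitting {u} {z} {v} pre post e = record
    { pre = pre ; post = post ; whole = e
    ; left  = sym (isPath⇒≡p (walk-prefix pre walk , Unique-++⁻ˡ (pre ++ [ z ]) (subst Unique e' (p-unique u v))))
    ; right = sym (isPath⇒≡p (walk-suffix pre walk , Unique-++⁻ʳ pre (subst Unique e (p-unique u v)))) }
    where
    walk : Walk u v (pre ++ z ∷ post)
    walk = subst (Walk u v) e (p-walk u v)
    e' : p u v ≡ (pre ++ [ z ]) ++ post
    e' = trans e (sym (++-assoc pre [ z ] post))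

  split-at : ∀ {u z v} → z ∈ p u v → Splitting u z v
  split-at i with ∈-∃++ i
  ... | pre , post , e = splitting pre post e

  ∈p-split : ∀ {u z v y} → z ∈ p u v → y ∈ p u v → y ∈ p u z ⊎ y ∈ p z v
  ∈p-split {y = y} z∈ y∈ with split-at z∈
  ... | record { pre = pre ; whole = whole ; left = left ; right = right }
      with ∈-++⁻ pre (subst (y ∈_) whole y∈)
  ... | inj₁ k = inj₁ (subst (y ∈_) (sym left) (∈-++⁺ˡ k))
  ... | inj₂ k = inj₂ (subst (y ∈_) (sym right) k)

  ∈p-left⇒∈p : ∀ {u z v y} → z ∈ p u v → y ∈ p u z → y ∈ p u v
  ∈p-left⇒∈p {y = y} z∈ y∈ with split-at z∈
  ... | record { pre = pre ; whole = whole ; left = left }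
      with ∈-++⁻ pre (subst (y ∈_) left y∈)
  ... | inj₁ k = subst (y ∈_) (sym whole) (∈-++⁺ˡ k)
  ... | inj₂ (here refl) = z∈

  ∈p-right⇒∈p : ∀ {u z v y} → z ∈ p u v → y ∈ p z v → y ∈ p u v
  ∈p-right⇒∈p {y = y} z∈ y∈ with split-at z∈
  ... | record { pre = pre ; whole = whole ; right = right } =
    subst (y ∈_) (sym whole) (∈-++⁺ʳ pre (subst (y ∈_) right y∈))

  ∈p-left∩right : ∀ {u z v y} → z ∈ p u v → y ∈ p u z → y ∈ p z v → y ≡ z
  ∈p-left∩right {u} {v = v} {y} z∈ y∈ˡ y∈ʳ with split-at z∈
  ... | record { pre = pre ; whole = whole ; left = left ; right = right }
      with ∈-++⁻ pre (subst (y ∈_) left y∈ˡ)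
  ... | inj₂ (here refl) = refl
  ... | inj₁ k = ⊥-elim (Unique-++⇒Disjoint pre (subst Unique whole (p-unique u v)) k (subst (y ∈_) right y∈ʳ))

  meet-only-at⇒∈p : ∀ {u z v} → (∀ {y} → y ∈ p u z → y ∈ p z v → y ≡ z) → z ∈ p u v
  meet-only-at⇒∈p {u} {z} {v} meet with walk-last (p-walk u z) | walk-head (p-walk z v)
  ... | pre , e₁ | post , e₂ = subst (z ∈_) concat≡p (∈-++⁺ʳ pre (here refl))
    where
    assoc : (pre ++ [ z ]) ++ post ≡ pre ++ z ∷ post
    assoc = ++-assoc pre [ z ] post
    post! : Unique post
    post! with subst Unique e₂ (p-unique z v)
    ... | _ ∷ u = u
    disjoint : ∀ {y} → y ∈ pre ++ [ z ] × y ∈ post → ⊥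
    disjoint {y} (y∈ˡ , y∈post) with meet (subst (y ∈_) (sym e₁) y∈ˡ) (subst (y ∈_) (sym e₂) (there y∈post))
    ... | refl = Uniqueₚ.Unique[x∷xs]⇒x∉xs (subst Unique e₂ (p-unique z v)) y∈post
    concat≡p : pre ++ z ∷ post ≡ p u v
    concat≡p = isPath⇒≡p
      ( subst (Walk u v) assoc (walk-++ (subst (Walk u z) e₁ (p-walk u z)) (subst (Walk z v) e₂ (p-walk z v)))
      , subst Unique assoc (Uniqueₚ.++⁺ (subst Unique e₁ (p-unique u z)) post! disjoint) )

  ∈p-shrinkˡ : ∀ {u z v y} → z ∈ p u v → y ∈ p u z → z ∈ p y v
  ∈p-shrinkˡ z∈ y∈ = meet-only-at⇒∈p λ q∈ˡ q∈ʳ → ∈p-left∩right z∈ (∈p-right⇒∈p y∈ q∈ˡ) q∈ʳ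

  ∈p-shrinkʳ : ∀ {u z v y} → z ∈ p u v → y ∈ p z v → z ∈ p u y
  ∈p-shrinkʳ z∈ y∈ = ∈p-sym (∈p-shrinkˡ (∈p-sym z∈) (∈p-sym y∈))

  ∈p-extendʳ : ∀ {x y z w} → y ∈ p x z → z ∈ p y w → y ≢ z → y ∈ p x w
  ∈p-extendʳ {x} {y} {z} {w} y∈ z∈ y≢z = meet-only-at⇒∈p meet
    where
    meet : ∀ {q} → q ∈ p x y → q ∈ p y w → q ≡ y
    meet q∈xy q∈yw with ∈p-split z∈ q∈yw
    ... | inj₁ q∈yz = ∈p-left∩right y∈ q∈xy q∈yz
    ... | inj₂ q∈zw = ⊥-elim (y≢z (∈p-left∩right z∈ (source∈p y z)
                                     (∈p-left⇒∈p q∈zw (∈p-sym (∈p-shrinkˡ y∈ q∈xy)))))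

  ∈p-extendˡ : ∀ {x y z w} → y ∈ p x z → z ∈ p y w → y ≢ z → z ∈ p x w
  ∈p-extendˡ y∈ z∈ y≢z = ∈p-sym (∈p-extendʳ (∈p-sym z∈) (∈p-sym y∈) (≢-sym y≢z))

  IsMedian : V → V → V → V → Set
  IsMedian y u v w = y ∈ p u v × y ∈ p u w × y ∈ p v w

  median : ∀ u v w → Σ V λ y → IsMedian y u v w
  median u v w with first-satisfying (_∈ p v w) (_∈? p v w) (p u v) (target∈p u v) (source∈p v w)
  ... | pre , y , post , e , y∈vw , before = y , y∈uv , meet-only-at⇒∈p meet , y∈vw
    where
    y∈uv : y ∈ p u v
    y∈uv = subst (y ∈_) (sym e) (∈-++⁺ʳ pre (here refl))
    meet : ∀ {q} → q ∈ p u y → q ∈ p y w → q ≡ y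
    meet {q} q∈uy q∈yw with ∈-++⁻ pre (subst (q ∈_) (Splitting.left (splitting pre post e)) q∈uy)
    ... | inj₁ k = ⊥-elim (before k (∈p-right⇒∈p y∈vw q∈yw))
    ... | inj₂ (here refl) = refl

  median-sym₁₂ : ∀ {y u v w} → IsMedian y u v w → IsMedian y v u w
  median-sym₁₂ (yuv , yuw , yvw) = ∈p-sym yuv , yvw , yuw

  private
    median-unique-towards : ∀ {u v w y y'} → IsMedian y u v w → IsMedian y' u v w → y' ∈ p u y → y ≡ y'
    median-unique-towards (yuv , yuw , _) (_ , _ , y'vw) y'∈ =
      ∈p-left∩right y'vw (∈p-sym (∈p-shrinkˡ yuv y'∈)) (∈p-shrinkˡ yuw y'∈)

  median-unique : ∀ {u v w y y'} → IsMedian y u v w → IsMedian y' u v w → y ≡ y'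
  median-unique my@(yuv , _ , _) my'@(y'uv , _ , _) with ∈p-split yuv y'uv
  ... | inj₁ y'∈uy = median-unique-towards my my' y'∈uy
  ... | inj₂ y'∈yv = median-unique-towards (median-sym₁₂ my) (median-sym₁₂ my') (∈p-sym y'∈yv)

  ∈p-triangle : ∀ {u v₁ v₂ y} → y ∈ p v₁ v₂ → y ∈ p u v₁ ⊎ y ∈ p u v₂
  ∈p-triangle {u} {v₁} {v₂} y∈ with median u v₁ v₂
  ... | _ , (c∈uv₁ , c∈uv₂ , c∈v₁v₂) with ∈p-split c∈v₁v₂ y∈
  ... | inj₁ k = inj₁ (∈p-right⇒∈p c∈uv₁ (∈p-sym k))
  ... | inj₂ k = inj₂ (∈p-right⇒∈p c∈uv₂ k)

  open RealFieldProperties ℝ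

  weight-++ : ∀ pre {z} post → weight (pre ++ z ∷ post) ≈ weight (pre ++ [ z ]) + weight (z ∷ post)
  weight-++ []            post = ≈-sym (+-identityˡ _)
  weight-++ (_ ∷ [])      post = ≈-sym (+-congʳ (+-identityʳ _))
  weight-++ (_ ∷ y ∷ pre) post = ≈-trans (+-congˡ (weight-++ (y ∷ pre) post)) (≈-sym (+-assoc _ _ _))

  D-split : ∀ {u z v} → z ∈ p u v → D u v ≈ D u z + D z v
  D-split z∈ with split-at z∈
  ... | record { pre = pre ; post = post ; whole = whole ; left = left ; right = right }
    rewrite whole | left | right = weight-++ pre post

  weight-reverse : ∀ xs → weight (reverse xs) ≈ weight xs
  weight-reverse []          = ≈-refl
  weight-reverse (_ ∷ [])    = ≈-refl
  weight-reverse (x ∷ y ∷ xs) = snoc-step (weight-reverse (y ∷ xs))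
    where
    snoc-step : weight (reverse (y ∷ xs)) ≈ weight (y ∷ xs) → weight (reverse (x ∷ y ∷ xs)) ≈ weight (x ∷ y ∷ xs)
    snoc-step ih rewrite unfold-reverse x (y ∷ xs) | unfold-reverse y xs | ++-assoc (reverse xs) [ y ] [ x ] =
      ≈-trans (weight-++ (reverse xs) [ x ])
        (≈-trans (+-cong ih (+-identityʳ _)) (≈-trans (+-comm _ _) (+-congʳ (w-sym y x))))

  D-sym : ∀ u v → D u v ≈ D v u
  D-sym u v rewrite p-reverse u v = ≈-sym (weight-reverse (p u v))

  D-split′ : ∀ {u v y} → y ∈ p u v → D u v ≈ D u y + D v y
  D-split′ {v = v} {y} y∈ = ≈-trans (D-split y∈) (+-congˡ (D-sym y v))

  Consec-p⇒∈p : ∀ {u v x y} → Consec (p u v) x y → x ∈ p u v × y ∈ p u v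
  Consec-p⇒∈p {u} {v} {x} {y} c with Consec⇒split c
  ... | pre , post , e = subst (x ∈_) (sym e) (∈-++⁺ʳ pre (here refl))
                       , subst (y ∈_) (sym e) (∈-++⁺ʳ pre (there (here refl)))

  Consec-p⇒≢target : ∀ {u v x y} → Consec (p u v) x y → x ≢ v
  Consec-p⇒≢target {u} {v} {x} {y} c refl with Consec⇒split c
  ... | pre , post , e with trans (sym (Splitting.right (splitting pre (y ∷ post) e))) (p-refl x)
  ... | ()

  Consec-p⇒Adj : ∀ {u v x y} → Consec (p u v) x y → Adj x y
  Consec-p⇒Adj = walk-Consec⇒Adj (p-walk _ _)

  Consec-p-sym : ∀ {u v x y} → Consec (p u v) x y → Consec (p v u) y x
  Consec-p-sym {u} {v} c = subst (λ q → Consec q _ _) (sym (p-reverse u v)) (Consec-reverse c)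

  EdgeOn-p-sym : ∀ {u v x y} → EdgeOn (p u v) x y → EdgeOn (p v u) x y
  EdgeOn-p-sym (inj₁ c) = inj₂ (Consec-p-sym c)
  EdgeOn-p-sym (inj₂ c) = inj₁ (Consec-p-sym c)

  EdgeOn-p⇒∈p : ∀ {u v x y} → EdgeOn (p u v) x y → x ∈ p u v × y ∈ p u v
  EdgeOn-p⇒∈p (inj₁ c) = Consec-p⇒∈p c
  EdgeOn-p⇒∈p (inj₂ c) = swap (Consec-p⇒∈p c)

  EdgeOn-p⇒≢ : ∀ {u v x y} → EdgeOn (p u v) x y → x ≢ y
  EdgeOn-p⇒≢ (inj₁ c) refl = Adj-irrefl (Consec-p⇒Adj c)
  EdgeOn-p⇒≢ (inj₂ c) refl = Adj-irrefl (Consec-p⇒Adj c)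

  ¬EdgeOn-p-refl : ∀ {u x y} → ¬ EdgeOn (p u u) x y
  ¬EdgeOn-p-refl {u} e with EdgeOn-p⇒∈p e | p-refl u
  ... | x∈ , y∈ | pu≡ = EdgeOn-p⇒≢ e (trans (Any.singleton⁻ (subst (_ ∈_) pu≡ x∈)) (sym (Any.singleton⁻ (subst (_ ∈_) pu≡ y∈))))

  EdgeOn-left⇒EdgeOn : ∀ {u z v x y} → z ∈ p u v → EdgeOn (p u z) x y → EdgeOn (p u v) x y
  EdgeOn-left⇒EdgeOn {z = z} z∈ e with split-at z∈
  ... | record { pre = pre ; post = post ; whole = whole ; left = left }
    rewrite whole | left | sym (++-assoc pre [ z ] post) = map (Consec-++⁺ˡ post) (Consec-++⁺ˡ post) e

  EdgeOn-right⇒EdgeOn : ∀ {u z v x y} → z ∈ p u v → EdgeOn (p z v) x y → EdgeOn (p u v) x y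
  EdgeOn-right⇒EdgeOn z∈ e with split-at z∈
  ... | record { pre = pre ; whole = whole ; right = right }
    rewrite whole | right = map (Consec-++⁺ʳ pre) (Consec-++⁺ʳ pre) e

  EdgeOn-split : ∀ {u z v x y} → z ∈ p u v → EdgeOn (p u v) x y → EdgeOn (p u z) x y ⊎ EdgeOn (p z v) x y
  EdgeOn-split z∈ e with split-at z∈
  ... | record { pre = pre ; whole = whole ; left = left ; right = right }
    rewrite whole | left | right with e
  ... | inj₁ c = map inj₁ inj₁ (Consec-++⁻ pre c)
  ... | inj₂ c = map inj₂ inj₂ (Consec-++⁻ pre c)

  EdgeOn-subpath : ∀ {u v u₁ u₂ x y} → u₁ ∈ p u v → u₂ ∈ p u v → EdgeOn (p u₁ u₂) x y → EdgeOn (p u v) x y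
  EdgeOn-subpath u₁∈ u₂∈ e with ∈p-split u₁∈ u₂∈
  ... | inj₂ k = EdgeOn-right⇒EdgeOn u₁∈ (EdgeOn-left⇒EdgeOn k e)
  ... | inj₁ k = EdgeOn-left⇒EdgeOn u₁∈ (EdgeOn-right⇒EdgeOn k (EdgeOn-p-sym e))

  FirstStep : V → V → V → Set
  FirstStep y l k = Σ (List V) λ r → p y l ≡ y ∷ k ∷ r

  first-step : ∀ {y l} → y ≢ l → Σ V (FirstStep y l)
  first-step {y} {l} y≢l = go (p-walk y l)
    where
    go : ∀ {ps} → Walk y l ps → Σ V λ k → Σ (List V) λ r → ps ≡ y ∷ k ∷ r
    go single = ⊥-elim (y≢l refl)
    go (step {x = k} _ w') with walk-head w'
    ... | r , refl = k , r , refl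

  FirstStep⇒Consec : ∀ {y l k} → FirstStep y l k → Consec (p y l) y k
  FirstStep⇒Consec (_ , e) = subst (λ q → Consec q _ _) (sym e) here

  FirstStep⇒Adj : ∀ {y l k} → FirstStep y l k → Adj y k
  FirstStep⇒Adj s = Consec-p⇒Adj (FirstStep⇒Consec s)

  FirstStep⇒≢ : ∀ {y l k} → FirstStep y l k → y ≢ k
  FirstStep⇒≢ s refl = Adj-irrefl (FirstStep⇒Adj s)

  FirstStep⇒∈p : ∀ {y l k} → FirstStep y l k → k ∈ p y l
  FirstStep⇒∈p s = proj₂ (Consec-p⇒∈p (FirstStep⇒Consec s))

  FirstStep-functional : ∀ {y l k k'} → FirstStep y l k → FirstStep y l k' → k ≡ k'
  FirstStep-functional (_ , e) (_ , e') with trans (sym e) e'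
  ... | refl = refl

  FirstStep-prefix : ∀ {y l k q} → FirstStep y l k → q ∈ p y l → q ≢ y → FirstStep y q k
  FirstStep-prefix (r , e) q∈ q≢y with split-at q∈
  ... | record { pre = pre ; whole = whole ; left = left } with prefix-keeps-head pre (trans (sym whole) e) q≢y
  ... | r' , e' = r' , trans left e'

  distinct-first-steps⇒∈p : ∀ {y l₁ l₂ k₁ k₂} → FirstStep y l₁ k₁ → FirstStep y l₂ k₂ → k₁ ≢ k₂ → y ∈ p l₁ l₂
  distinct-first-steps⇒∈p {y} s₁ s₂ k₁≢k₂ = meet-only-at⇒∈p meet
    where
    meet : ∀ {q} → q ∈ p _ y → q ∈ p y _ → q ≡ y
    meet {q} q∈₁ q∈₂ with q ≟ y
    ... | yes q≡y = q≡y
    ... | no q≢y = ⊥-elim (k₁≢k₂ (FirstStep-functional (FirstStep-prefix s₁ (∈p-sym q∈₁) q≢y) (FirstStep-prefix s₂ q∈₂ q≢y)))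

  ∈p⇒distinct-first-steps : ∀ {y u v k₁ k₂} → y ∈ p u v → FirstStep y u k₁ → FirstStep y v k₂ → k₁ ≢ k₂
  ∈p⇒distinct-first-steps y∈ s₁ s₂ refl =
    FirstStep⇒≢ s₁ (sym (∈p-left∩right y∈ (∈p-sym (FirstStep⇒∈p s₁)) (FirstStep⇒∈p s₂)))

  interior⇒¬IsLeaf : ∀ {u v y} → y ∈ p u v → y ≢ u → y ≢ v → ¬ IsLeaf y
  interior⇒¬IsLeaf y∈ y≢u y≢v (_ , _ , unique-neighbour) with first-step y≢u | first-step y≢v
  ... | k₁ , s₁ | k₂ , s₂ = ∈p⇒distinct-first-steps y∈ s₁ s₂
    (trans (unique-neighbour k₁ (FirstStep⇒Adj s₁)) (sym (unique-neighbour k₂ (FirstStep⇒Adj s₂))))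

  IsLeaf∈p⇒endpoint : ∀ {u v y} → IsLeaf y → y ∈ p u v → y ≡ u ⊎ y ≡ v
  IsLeaf∈p⇒endpoint {u} {v} {y} leaf-y y∈ with y ≟ u | y ≟ v
  ... | yes e | _     = inj₁ e
  ... | no _  | yes e = inj₂ e
  ... | no y≢u | no y≢v = ⊥-elim (interior⇒¬IsLeaf y∈ y≢u y≢v leaf-y)

  median-of-distinct⇒¬IsLeaf : ∀ {u v w y} → u ≢ v → u ≢ w → v ≢ w → IsMedian y u v w → ¬ IsLeaf y
  median-of-distinct⇒¬IsLeaf u≢v u≢w v≢w (yuv , yuw , yvw) leaf-y with IsLeaf∈p⇒endpoint leaf-y yuv
  ... | inj₁ refl = [ u≢v , u≢w ]′ (IsLeaf∈p⇒endpoint leaf-y yvw)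
  ... | inj₂ refl = [ ≢-sym u≢v , v≢w ]′ (IsLeaf∈p⇒endpoint leaf-y yuw)

  FirstStep? : ∀ y l k → Dec (FirstStep y l k)
  FirstStep? y l k = starts-with (p y l)
    where
    starts-with : ∀ xs → Dec (Σ (List V) λ r → xs ≡ y ∷ k ∷ r)
    starts-with []    = no λ { (_ , ()) }
    starts-with (_ ∷ []) = no λ { (_ , ()) }
    starts-with (a ∷ b ∷ r) with a ≟ y | b ≟ k
    ... | yes refl | yes refl = yes (r , refl)
    ... | no a≢y   | _        = no λ { (_ , refl) → a≢y refl }
    ... | yes _    | no b≢k   = no λ { (_ , refl) → b≢k refl }

  FirstStep-extend : ∀ {y l l' k} → FirstStep y l k → l ∈ p y l' → FirstStep y l' k
  FirstStep-extend (r , e) l∈ with split-at l∈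
  ... | record { pre = pre ; whole = whole ; left = left } with extension-keeps-head pre (trans (sym left) e)
  ... | r' , e' = r' , trans whole e'

  length-p-extend : ∀ {y l l'} → l ∈ p y l' → l ≢ l' → length (p y l) <ℕ length (p y l')
  length-p-extend {y} {l} {l'} l∈ l≢l' with split-at l∈
  ... | record { pre = pre ; post = post ; whole = whole ; left = left ; right = right }
    rewrite whole | left with post | right
  ... | [] | l-l'≡ = ⊥-elim (l≢l' (sym (Any.singleton⁻ (subst (l' ∈_) l-l'≡ (target∈p l l')))))
  ... | _ ∷ _ | _ = subst₂ _<ℕ_ (sym (length-++ pre)) (sym (length-++ pre))
                      (+-monoʳ-< (length pre) (s≤s (s≤s z≤n)))

  leaf-beyond : ∀ {v u} → Adj v u → Σ V λ l → IsLeaf l × FirstStep v l u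
  leaf-beyond {v} {u} vu = z , (k , FirstStep⇒Adj z→k , only-neighbour) , v→z
    where
    -- the farthest vertex reached through u is a leaf: any other neighbour would lie farther
    farthest : Σ V λ z → FirstStep v z u × (∀ {z'} → z' ∈ allFin m → FirstStep v z' u → length (p v z') ≤ℕ length (p v z))
    farthest = argmax (λ z → length (p v z)) (λ z → FirstStep? v z u) ([] , Adj⇒p vu) (allFin m)
    z : V
    z = proj₁ farthest
    v→z : FirstStep v z u
    v→z = proj₁ (proj₂ farthest)
    z≢v : z ≢ v
    z≢v z≡v with trans (sym (p-refl v)) (subst (λ q → p v q ≡ v ∷ u ∷ proj₁ v→z) z≡v (proj₂ v→z))
    ... | ()
    k : V
    k = proj₁ (first-step z≢v)
    z→k : FirstStep z v k
    z→k = proj₂ (first-step z≢v)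
    only-neighbour : ∀ u' → Adj z u' → u' ≡ k
    only-neighbour u' zu' with u' ≟ k
    ... | yes u'≡k = u'≡k
    ... | no u'≢k = ⊥-elim (<⇒≱ (length-p-extend z∈ z≢u') (proj₂ (proj₂ farthest) (∈-allFin u') (FirstStep-extend v→z z∈)))
      where
      z∈ : z ∈ p v u'
      z∈ = distinct-first-steps⇒∈p z→k ([] , Adj⇒p zu') (≢-sym u'≢k)
      z≢u' : z ≢ u'
      z≢u' refl = Adj-irrefl zu'

  ∈p-to-median⇒≡ : ∀ {x a b r y} → IsMedian r x a b → y ∈ p x r → y ∈ p a b → y ≡ r
  ∈p-to-median⇒≡ (rxa , rxb , rab) y∈xr y∈ab with ∈p-split rab y∈ab
  ... | inj₁ k = ∈p-left∩right rxa y∈xr (∈p-sym k)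
  ... | inj₂ k = ∈p-left∩right rxb y∈xr k

  length≡2⇒endpoints : ∀ {u v y} → u ≢ v → length (p u v) ≡ 2 → y ∈ p u v → y ≡ u ⊎ y ≡ v
  length≡2⇒endpoints {u} {v} {y} u≢v length≡2 y∈ with first-step u≢v
  ... | k , [] , e with subst (y ∈_) e y∈ | subst (v ∈_) e (target∈p u v)
  ...   | here y≡u         | _                 = inj₁ y≡u
  ...   | there (here y≡k) | here v≡u          = ⊥-elim (u≢v (sym v≡u))
  ...   | there (here y≡k) | there (here v≡k) = inj₂ (trans y≡k (sym v≡k))
  length≡2⇒endpoints u≢v length≡2 y∈ | k , _ ∷ _ , e with trans (sym length≡2) (cong length e)
  ... | ()

module InternalPositiveTree {ℝ : RealField} {m : ℕ} (T : WTree ℝ m)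
         (essential : TreeDefs.Essential T) (internal-positive : TreeDefs.InternalPositive T) where
  open WTree T
  open TreeDefs T
  open TreePaths T
  open RealFieldProperties ℝ

  twig-interior-empty : ∀ {F N x} → (∀ z → z ∈ p F N → IsNode z → z ≡ N) → x ∈ p F N → x ≢ F → x ≢ N → ⊥
  twig-interior-empty {F} {N} {x} only-node x∈ x≢F x≢N with first-step x≢F | first-step x≢N
  ... | k₁ , s₁ | k₂ , s₂ = essential x (k₁ , k₂ , k₁≢k₂ , FirstStep⇒Adj s₁ , FirstStep⇒Adj s₂ , two-neighbours)
    where
    k₁≢k₂ : k₁ ≢ k₂
    k₁≢k₂ = ∈p⇒distinct-first-steps x∈ s₁ s₂
    two-neighbours : ∀ u → Adj x u → u ≡ k₁ ⊎ u ≡ k₂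
    two-neighbours u xu with u ≟ k₁ | u ≟ k₂
    ... | yes e    | _        = inj₁ e
    ... | no _     | yes e    = inj₂ e
    ... | no u≢k₁ | no u≢k₂ = ⊥-elim (x≢N (only-node x x∈
          (k₁ , k₂ , u , k₁≢k₂ , ≢-sym u≢k₁ , ≢-sym u≢k₂ , FirstStep⇒Adj s₁ , FirstStep⇒Adj s₂ , xu)))

  twig-edge⇒IsLeaf : ∀ {F N x y} → IsLeaf F → (∀ z → z ∈ p F N → IsNode z → z ≡ N) → Consec (p F N) x y → IsLeaf x
  twig-edge⇒IsLeaf {F} {x = x} leaf-F only-node c with x ≟ F
  ... | yes refl = leaf-F
  ... | no x≢F = ⊥-elim (twig-interior-empty only-node (proj₁ (Consec-p⇒∈p c)) x≢F (Consec-p⇒≢target c))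

  OnTwig⇒IsLeaf : ∀ {x y} → OnTwig x y → IsLeaf x ⊎ IsLeaf y
  OnTwig⇒IsLeaf (F , N , leaf-F , _ , only-node , inj₁ c) = inj₁ (twig-edge⇒IsLeaf leaf-F only-node c)
  OnTwig⇒IsLeaf (F , N , leaf-F , _ , only-node , inj₂ c) = inj₂ (twig-edge⇒IsLeaf leaf-F only-node c)

  Consec-p⇒¬IsLeaf : ∀ {u v x y} → ¬ IsLeaf u → Consec (p u v) x y → ¬ IsLeaf x
  Consec-p⇒¬IsLeaf {u} {x = x} ¬leaf-u c with x ≟ u
  ... | yes refl = ¬leaf-u
  ... | no x≢u = interior⇒¬IsLeaf (proj₁ (Consec-p⇒∈p c)) x≢u (Consec-p⇒≢target c)

  Consec-p⇒0<w : ∀ {u v x y} → ¬ IsLeaf u → ¬ IsLeaf v → Consec (p u v) x y → 0# < w x y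
  Consec-p⇒0<w {u} {v} ¬leaf-u ¬leaf-v c = internal-positive _ _ (Consec-p⇒Adj c) not-on-twig
    where
    not-on-twig : ¬ OnTwig _ _
    not-on-twig t with OnTwig⇒IsLeaf t
    ... | inj₁ leaf-x = Consec-p⇒¬IsLeaf ¬leaf-u c leaf-x
    ... | inj₂ leaf-y = Consec-p⇒¬IsLeaf ¬leaf-v (Consec-p-sym c) leaf-y

  weight-pos-edges⇒nonneg : ∀ xs → (∀ {x y} → Consec xs x y → 0# < w x y) → 0# ≤ weight xs
  weight-pos-edges⇒nonneg []          _   = inj₂ ≈-refl
  weight-pos-edges⇒nonneg (_ ∷ [])    _   = inj₂ ≈-refl
  weight-pos-edges⇒nonneg (_ ∷ y ∷ r) pos =
    inj₁ (<-respʳ-≈ (+-comm _ _) (+-nonneg-pos (weight-pos-edges⇒nonneg (y ∷ r) (λ c → pos (there c))) (pos here)))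

  D-pos : ∀ {u v} → ¬ IsLeaf u → ¬ IsLeaf v → u ≢ v → 0# < D u v
  D-pos {u} {v} ¬leaf-u ¬leaf-v u≢v with first-step u≢v
  ... | k , r , e = subst (λ q → 0# < weight q) (sym e)
    (<-respʳ-≈ (+-comm _ _) (+-nonneg-pos (weight-pos-edges⇒nonneg (k ∷ r) (λ c → edge-pos (there c))) (edge-pos here)))
    where
    edge-pos : ∀ {x y} → Consec (u ∷ k ∷ r) x y → 0# < w x y
    edge-pos c = Consec-p⇒0<w ¬leaf-u ¬leaf-v (subst (λ q → Consec q _ _) (sym e) c)

-- Quartets

module MinimalSubtrees {ℝ : RealField} {m : ℕ} (T : WTree ℝ m) where
  open WTree T
  open TreeDefs T
  open TreePaths T

  SubE⇒FirstStep : ∀ {U : V → Set} {x y} → SubE U x y → Σ V λ l → U l × FirstStep x l y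
  SubE⇒FirstStep (u , v , _ , Uv , inj₁ c) with Consec⇒split c
  ... | pre , post , e = v , Uv , post , Splitting.right (splitting pre _ e)
  SubE⇒FirstStep (u , v , Uu , _ , inj₂ c) with Consec⇒split (Consec-p-sym c)
  ... | pre , post , e = u , Uu , post , Splitting.right (splitting pre _ e)

  FirstStep⇒SubE : ∀ {U : V → Set} {y l l' k} → U l' → U l → y ∈ p l' l → FirstStep y l k → SubE U y k
  FirstStep⇒SubE Ul' Ul y∈ s = _ , _ , Ul' , Ul , EdgeOn-right⇒EdgeOn y∈ (inj₁ (FirstStep⇒Consec s))

  record MedianOf3 (U : V → Set) (y : V) : Set where
    field
      {l₁ l₂ l₃} : V
      U₁ : U l₁
      U₂ : U l₂
      U₃ : U l₃
      l₁≢l₂ : l₁ ≢ l₂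
      l₁≢l₃ : l₁ ≢ l₃
      l₂≢l₃ : l₂ ≢ l₃
      median₁₂₃ : IsMedian y l₁ l₂ l₃

  -- three edges of U's subtree at y point towards three different members of U
  SubNode⇒MedianOf3 : ∀ {U : V → Set} {y} → SubNode U y → MedianOf3 U y
  SubNode⇒MedianOf3 (_ , _ , _ , _ , k₁≢k₂ , k₁≢k₃ , k₂≢k₃ , e₁ , e₂ , e₃)
    with SubE⇒FirstStep e₁ | SubE⇒FirstStep e₂ | SubE⇒FirstStep e₃
  ... | l₁ , U₁ , s₁ | l₂ , U₂ , s₂ | l₃ , U₃ , s₃ = record
    { U₁ = U₁ ; U₂ = U₂ ; U₃ = U₃
    ; l₁≢l₂ = λ { refl → k₁≢k₂ (FirstStep-functional s₁ s₂) }
    ; l₁≢l₃ = λ { refl → k₁≢k₃ (FirstStep-functional s₁ s₃) }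
    ; l₂≢l₃ = λ { refl → k₂≢k₃ (FirstStep-functional s₂ s₃) }
    ; median₁₂₃ = distinct-first-steps⇒∈p s₁ s₂ k₁≢k₂ , distinct-first-steps⇒∈p s₁ s₃ k₁≢k₃
                , distinct-first-steps⇒∈p s₂ s₃ k₂≢k₃ }

  median-of-leaves⇒SubNode : ∀ {U : V → Set} {y l₁ l₂ l₃} →
    IsLeaf l₁ → IsLeaf l₂ → IsLeaf l₃ → l₁ ≢ l₂ → l₁ ≢ l₃ → l₂ ≢ l₃ →
    U l₁ → U l₂ → U l₃ → IsMedian y l₁ l₂ l₃ → SubNode U y
  median-of-leaves⇒SubNode {U} {y} {l₁} {l₂} {l₃} leaf₁ leaf₂ leaf₃ l₁≢l₂ l₁≢l₃ l₂≢l₃ U₁ U₂ U₃ my@(y₁₂ , y₁₃ , y₂₃) =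
    node (first-step (y≢ leaf₁)) (first-step (y≢ leaf₂)) (first-step (y≢ leaf₃))
    where
    y≢ : ∀ {l} → IsLeaf l → y ≢ l
    y≢ leaf-l refl = median-of-distinct⇒¬IsLeaf l₁≢l₂ l₁≢l₃ l₂≢l₃ my leaf-l
    node : Σ V (FirstStep y l₁) → Σ V (FirstStep y l₂) → Σ V (FirstStep y l₃) → SubNode U y
    node (k₁ , s₁) (k₂ , s₂) (k₃ , s₃) =
      (_ , _ , U₁ , U₂ , y₁₂) , k₁ , k₂ , k₃ ,
      ∈p⇒distinct-first-steps y₁₂ s₁ s₂ , ∈p⇒distinct-first-steps y₁₃ s₁ s₃ , ∈p⇒distinct-first-steps y₂₃ s₂ s₃ ,
      FirstStep⇒SubE U₂ U₁ (∈p-sym y₁₂) s₁ , FirstStep⇒SubE U₁ U₂ y₁₂ s₂ , FirstStep⇒SubE U₁ U₃ y₁₃ s₃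

module Quartets {ℝ : RealField} {m : ℕ} (T : WTree ℝ m) where
  open WTree T
  open TreeDefs T
  open TreePaths T
  open MinimalSubtrees T
  open RealFieldProperties ℝ
  open DecMembership (_≟_ {m}) using (_∈?_)

  -- ⟨A,B|C,D⟩ with stalks s = s_{A,B} and t = s_{C,D}
  record Resolved (A B C D s t : V) : Set where
    field
      sAB : s ∈ p A B
      sAC : s ∈ p A C
      sAD : s ∈ p A D
      sBC : s ∈ p B C
      sBD : s ∈ p B D
      tCD : t ∈ p C D
      tAC : t ∈ p A C
      tAD : t ∈ p A D
      tBC : t ∈ p B C
      tBD : t ∈ p B D
      s≢t : s ≢ t

  record Star (A B C D s : V) : Set where
    field
      sAB : s ∈ p A B
      sAC : s ∈ p A C
      sAD : s ∈ p A D
      sBC : s ∈ p B C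
      sBD : s ∈ p B D
      sCD : s ∈ p C D

  module _ {A B C D s t} (τ : Resolved A B C D s t) where
    open Resolved τ

    Resolved-swapˡ : Resolved B A C D s t
    Resolved-swapˡ = record { sAB = ∈p-sym sAB ; sAC = sBC ; sAD = sBD ; sBC = sAC ; sBD = sAD
                            ; tCD = tCD ; tAC = tBC ; tAD = tBD ; tBC = tAC ; tBD = tAD ; s≢t = s≢t }

    Resolved-swapʳ : Resolved A B D C s t
    Resolved-swapʳ = record { sAB = sAB ; sAC = sAD ; sAD = sAC ; sBC = sBD ; sBD = sBC
                            ; tCD = ∈p-sym tCD ; tAC = tAD ; tAD = tAC ; tBC = tBD ; tBD = tBC ; s≢t = s≢t }

    Resolved-flip : Resolved C D A B t s
    Resolved-flip = record
      { sAB = tCD ; sAC = ∈p-sym tAC ; sAD = ∈p-sym tBC ; sBC = ∈p-sym tAD ; sBD = ∈p-sym tBD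
      ; tCD = sAB ; tAC = ∈p-sym sAC ; tAD = ∈p-sym sBC ; tBC = ∈p-sym sAD ; tBD = ∈p-sym sBD
      ; s≢t = ≢-sym s≢t }

    stalk-medianˡ : IsMedian s A B C
    stalk-medianˡ = sAB , sAC , sBC

    stalk-medianʳ : IsMedian t C D A
    stalk-medianʳ = tCD , ∈p-sym tAC , ∈p-sym tAD

    t∈p-s-C : t ∈ p s C
    t∈p-s-C with ∈p-split sAC tAC
    ... | inj₂ k = k
    ... | inj₁ k = ⊥-elim (s≢t (median-unique stalk-medianˡ (∈p-left⇒∈p sAB k , tAC , tBC)))

  module _ {A B C D s t} (τ : Resolved A B C D s t) where

    t∈p-s-D : t ∈ p s D
    t∈p-s-D = t∈p-s-C (Resolved-swapʳ τ)

    s∈p-t-A : s ∈ p t A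
    s∈p-t-A = t∈p-s-C (Resolved-flip τ)

    s∈p-t-B : s ∈ p t B
    s∈p-t-B = t∈p-s-C (Resolved-flip (Resolved-swapˡ τ))

  private
    resolve-at : ∀ {A B C D s} → IsMedian s A B C → s ∉ p D A → s ∈ p D B → s ∈ p D C →
                 Σ V λ s' → Resolved A D B C s' s
    resolve-at (sAB , sAC , sBC) s∉DA sDB sDC with median _ _ _
    ... | s' , (s'AD , s'As , s'Ds) = s' , record
      { sAB = s'AD ; sAC = ∈p-left⇒∈p sAB s'As ; sAD = ∈p-left⇒∈p sAC s'As
      ; sBC = ∈p-left⇒∈p sDB s'Ds ; sBD = ∈p-left⇒∈p sDC s'Ds
      ; tCD = sBC ; tAC = sAB ; tAD = sAC ; tBC = sDB ; tBD = sDC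
      ; s≢t = λ e → s∉DA (∈p-sym (subst (_∈ p _ _) e s'AD)) }

  data Shape (A B C D : V) : Set where
    star : ∀ s → Star A B C D s → Shape A B C D
    ab∣cd : ∀ s t → Resolved A B C D s t → Shape A B C D
    ac∣bd : ∀ s t → Resolved A C B D s t → Shape A B C D
    ad∣bc : ∀ s t → Resolved A D B C s t → Shape A B C D

  -- D pairs with the first of A, B, C whose path to D misses the median s of A, B, C; if none does, it is a star
  shape : ∀ A B C D → Shape A B C D
  shape A B C D with median A B C
  ... | s , ms@(sAB , sAC , sBC) with s ∈? p D A | s ∈? p D B | s ∈? p D C
  ... | no s∉DA | _ | _ =
    ad∣bc _ _ (proj₂ (resolve-at ms s∉DA (fromInj₂ (⊥-elim ∘ s∉DA) (∈p-triangle sAB)) (fromInj₂ (⊥-elim ∘ s∉DA) (∈p-triangle sAC))))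
  ... | yes sDA | no s∉DB | _ =
    ac∣bd _ _ (Resolved-flip (proj₂ (resolve-at (median-sym₁₂ ms) s∉DB sDA (fromInj₂ (⊥-elim ∘ s∉DB) (∈p-triangle sBC)))))
  ... | yes sDA | yes sDB | no s∉DC =
    ab∣cd _ _ (Resolved-flip (proj₂ (resolve-at (∈p-sym sAC , ∈p-sym sBC , sAB) s∉DC sDA sDB)))
  ... | yes sDA | yes sDB | yes sDC = star s (record
    { sAB = sAB ; sAC = sAC ; sAD = ∈p-sym sDA ; sBC = sBC ; sBD = ∈p-sym sDB ; sCD = ∈p-sym sDC })

  module _ where
    open SetoidReasoning setoid

    four-point-resolved : ∀ {a b c d s t} → Resolved a b c d s t →
      (D a c + D b d ≈ (D a b + D c d) + (D s t + D s t)) × (D a d + D b c ≈ D a c + D b d)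
    four-point-resolved {a} {b} {c} {d} {s} {t} τ = wide , equal
      where
      open Resolved τ
      via-t : ∀ {x y} → s ∈ p x y → t ∈ p s y → D x y ≈ D x s + (D s t + D y t)
      via-t s∈ t∈ = ≈-trans (D-split s∈) (+-congˡ (D-split′ t∈))
      wide : D a c + D b d ≈ (D a b + D c d) + (D s t + D s t)
      wide = begin
        D a c + D b d                                         ≈⟨ +-cong (via-t sAC (t∈p-s-C τ)) (via-t sBD (t∈p-s-D τ)) ⟩
        (D a s + (D s t + D c t)) + (D b s + (D s t + D d t)) ≈⟨ solve 5 (λ as bs st ct dt →
                                                                   (as :+ (st :+ ct)) :+ (bs :+ (st :+ dt))
                                                                := ((as :+ bs) :+ (ct :+ dt)) :+ (st :+ st)) ≈-refl
                                                                   (D a s) (D b s) (D s t) (D c t) (D d t) ⟩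
        ((D a s + D b s) + (D c t + D d t)) + (D s t + D s t)  ≈⟨ +-congʳ (+-cong (≈-sym (D-split′ sAB)) (≈-sym (D-split′ tCD))) ⟩
        (D a b + D c d) + (D s t + D s t)                      ∎
      equal : D a d + D b c ≈ D a c + D b d
      equal = begin
        D a d + D b c                                          ≈⟨ +-cong (via-t sAD (t∈p-s-D τ)) (via-t sBC (t∈p-s-C τ)) ⟩
        (D a s + (D s t + D d t)) + (D b s + (D s t + D c t))  ≈⟨ solve 5 (λ as bs st ct dt →
                                                                   (as :+ (st :+ dt)) :+ (bs :+ (st :+ ct))
                                                                := (as :+ (st :+ ct)) :+ (bs :+ (st :+ dt))) ≈-refl
                                                                   (D a s) (D b s) (D s t) (D c t) (D d t) ⟩
        (D a s + (D s t + D c t)) + (D b s + (D s t + D d t))  ≈⟨ ≈-sym (+-cong (via-t sAC (t∈p-s-C τ)) (via-t sBD (t∈p-s-D τ))) ⟩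
        D a c + D b d                                          ∎

    four-point-star : ∀ {a b c d s} → Star a b c d s →
      (D a c + D b d ≈ D a b + D c d) × (D a d + D b c ≈ D a b + D c d)
    four-point-star {a} {b} {c} {d} {s} σ =
        ≈-trans (through-s sAC sBD) (≈-trans (solve 4 (λ as bs cs ds → (as :+ cs) :+ (bs :+ ds) := (as :+ bs) :+ (cs :+ ds)) ≈-refl
                                                      (D a s) (D b s) (D c s) (D d s)) (≈-sym (through-s sAB sCD)))
      , ≈-trans (through-s sAD sBC) (≈-trans (solve 4 (λ as bs cs ds → (as :+ ds) :+ (bs :+ cs) := (as :+ bs) :+ (cs :+ ds)) ≈-refl
                                                      (D a s) (D b s) (D c s) (D d s)) (≈-sym (through-s sAB sCD)))
      where
      open Star σ
      through-s : ∀ {x y z w} → s ∈ p x y → s ∈ p z w → D x y + D z w ≈ (D x s + D y s) + (D z s + D w s)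
      through-s s∈xy s∈zw = +-cong (D-split′ s∈xy) (D-split′ s∈zw)

  InQuartet : V → V → V → V → V → Set
  InQuartet A B C D v = v ≡ A ⊎ v ≡ B ⊎ v ≡ C ⊎ v ≡ D

  private
    InQuartet-swapˡ : ∀ {A B C D v} → InQuartet A B C D v → InQuartet B A C D v
    InQuartet-swapˡ (inj₁ e)               = inj₂ (inj₁ e)
    InQuartet-swapˡ (inj₂ (inj₁ e))        = inj₁ e
    InQuartet-swapˡ (inj₂ (inj₂ e))        = inj₂ (inj₂ e)

    InQuartet-flip : ∀ {A B C D v} → InQuartet A B C D v → InQuartet C D A B v
    InQuartet-flip (inj₁ e)                = inj₂ (inj₂ (inj₁ e))
    InQuartet-flip (inj₂ (inj₁ e))         = inj₂ (inj₂ (inj₂ e))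
    InQuartet-flip (inj₂ (inj₂ (inj₁ e)))  = inj₁ e
    InQuartet-flip (inj₂ (inj₂ (inj₂ e)))  = inj₂ (inj₁ e)

    median-through-A : ∀ {A B C D s t y l l'} → Resolved A B C D s t →
      InQuartet A B C D l → InQuartet A B C D l' → A ≢ l → A ≢ l' → l ≢ l' → IsMedian y A l l' → y ≡ s ⊎ y ≡ t
    median-through-A τ (inj₁ refl) _ A≢l _ _ _ = ⊥-elim (A≢l refl)
    median-through-A τ _ (inj₁ refl) _ A≢l' _ _ = ⊥-elim (A≢l' refl)
    median-through-A τ (inj₂ (inj₁ refl)) (inj₂ (inj₁ refl)) _ _ l≢l' _ = ⊥-elim (l≢l' refl)
    median-through-A τ (inj₂ (inj₂ (inj₁ refl))) (inj₂ (inj₂ (inj₁ refl))) _ _ l≢l' _ = ⊥-elim (l≢l' refl)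
    median-through-A τ (inj₂ (inj₂ (inj₂ refl))) (inj₂ (inj₂ (inj₂ refl))) _ _ l≢l' _ = ⊥-elim (l≢l' refl)
    median-through-A τ (inj₂ (inj₁ refl)) (inj₂ (inj₂ (inj₁ refl))) _ _ _ my =
      inj₁ (median-unique my (sAB , sAC , sBC)) where open Resolved τ
    median-through-A τ (inj₂ (inj₁ refl)) (inj₂ (inj₂ (inj₂ refl))) _ _ _ my =
      inj₁ (median-unique my (sAB , sAD , sBD)) where open Resolved τ
    median-through-A τ (inj₂ (inj₂ (inj₁ refl))) (inj₂ (inj₁ refl)) _ _ _ my =
      inj₁ (median-unique my (sAC , sAB , ∈p-sym sBC)) where open Resolved τ
    median-through-A τ (inj₂ (inj₂ (inj₂ refl))) (inj₂ (inj₁ refl)) _ _ _ my =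
      inj₁ (median-unique my (sAD , sAB , ∈p-sym sBD)) where open Resolved τ
    median-through-A τ (inj₂ (inj₂ (inj₁ refl))) (inj₂ (inj₂ (inj₂ refl))) _ _ _ my =
      inj₂ (median-unique my (tAC , tAD , tCD)) where open Resolved τ
    median-through-A τ (inj₂ (inj₂ (inj₂ refl))) (inj₂ (inj₂ (inj₁ refl))) _ _ _ my =
      inj₂ (median-unique my (tAD , tAC , ∈p-sym tCD)) where open Resolved τ

  Resolved⇒quartet-medians : ∀ {A B C D s t y} → Resolved A B C D s t → MedianOf3 (InQuartet A B C D) y → y ≡ s ⊎ y ≡ t
  Resolved⇒quartet-medians τ record { U₁ = inj₁ refl ; U₂ = U₂ ; U₃ = U₃ ; l₁≢l₂ = l₁≢l₂ ; l₁≢l₃ = l₁≢l₃ ; l₂≢l₃ = l₂≢l₃ ; median₁₂₃ = my } =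
    median-through-A τ U₂ U₃ l₁≢l₂ l₁≢l₃ l₂≢l₃ my
  Resolved⇒quartet-medians τ record { U₁ = inj₂ (inj₁ refl) ; U₂ = U₂ ; U₃ = U₃ ; l₁≢l₂ = l₁≢l₂ ; l₁≢l₃ = l₁≢l₃ ; l₂≢l₃ = l₂≢l₃ ; median₁₂₃ = my } =
    median-through-A (Resolved-swapˡ τ) (InQuartet-swapˡ U₂) (InQuartet-swapˡ U₃) l₁≢l₂ l₁≢l₃ l₂≢l₃ my
  Resolved⇒quartet-medians τ record { U₁ = inj₂ (inj₂ (inj₁ refl)) ; U₂ = U₂ ; U₃ = U₃ ; l₁≢l₂ = l₁≢l₂ ; l₁≢l₃ = l₁≢l₃ ; l₂≢l₃ = l₂≢l₃ ; median₁₂₃ = my } =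
    Data.Sum.swap (median-through-A (Resolved-flip τ) (InQuartet-flip U₂) (InQuartet-flip U₃) l₁≢l₂ l₁≢l₃ l₂≢l₃ my)
  Resolved⇒quartet-medians τ record { U₁ = inj₂ (inj₂ (inj₂ refl)) ; U₂ = U₂ ; U₃ = U₃ ; l₁≢l₂ = l₁≢l₂ ; l₁≢l₃ = l₁≢l₃ ; l₂≢l₃ = l₂≢l₃ ; median₁₂₃ = my } =
    Data.Sum.swap (median-through-A (Resolved-swapˡ (Resolved-flip τ))
      (InQuartet-swapˡ (InQuartet-flip U₂)) (InQuartet-swapˡ (InQuartet-flip U₃)) l₁≢l₂ l₁≢l₃ l₂≢l₃ my)

  private
    Star⇒∈p : ∀ {A B C D s l l'} → Star A B C D s → InQuartet A B C D l → InQuartet A B C D l' → l ≢ l' → s ∈ p l l'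
    Star⇒∈p σ (inj₁ refl)               (inj₁ refl)               l≢l' = ⊥-elim (l≢l' refl)
    Star⇒∈p σ (inj₁ refl)               (inj₂ (inj₁ refl))        _    = Star.sAB σ
    Star⇒∈p σ (inj₁ refl)               (inj₂ (inj₂ (inj₁ refl))) _    = Star.sAC σ
    Star⇒∈p σ (inj₁ refl)               (inj₂ (inj₂ (inj₂ refl))) _    = Star.sAD σ
    Star⇒∈p σ (inj₂ (inj₁ refl))        (inj₁ refl)               _    = ∈p-sym (Star.sAB σ)
    Star⇒∈p σ (inj₂ (inj₁ refl))        (inj₂ (inj₁ refl))        l≢l' = ⊥-elim (l≢l' refl)
    Star⇒∈p σ (inj₂ (inj₁ refl))        (inj₂ (inj₂ (inj₁ refl))) _    = Star.sBC σ
    Star⇒∈p σ (inj₂ (inj₁ refl))        (inj₂ (inj₂ (inj₂ refl))) _    = Star.sBD σ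
    Star⇒∈p σ (inj₂ (inj₂ (inj₁ refl))) (inj₁ refl)               _    = ∈p-sym (Star.sAC σ)
    Star⇒∈p σ (inj₂ (inj₂ (inj₁ refl))) (inj₂ (inj₁ refl))        _    = ∈p-sym (Star.sBC σ)
    Star⇒∈p σ (inj₂ (inj₂ (inj₁ refl))) (inj₂ (inj₂ (inj₁ refl))) l≢l' = ⊥-elim (l≢l' refl)
    Star⇒∈p σ (inj₂ (inj₂ (inj₁ refl))) (inj₂ (inj₂ (inj₂ refl))) _    = Star.sCD σ
    Star⇒∈p σ (inj₂ (inj₂ (inj₂ refl))) (inj₁ refl)               _    = ∈p-sym (Star.sAD σ)
    Star⇒∈p σ (inj₂ (inj₂ (inj₂ refl))) (inj₂ (inj₁ refl))        _    = ∈p-sym (Star.sBD σ)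
    Star⇒∈p σ (inj₂ (inj₂ (inj₂ refl))) (inj₂ (inj₂ (inj₁ refl))) _    = ∈p-sym (Star.sCD σ)
    Star⇒∈p σ (inj₂ (inj₂ (inj₂ refl))) (inj₂ (inj₂ (inj₂ refl))) l≢l' = ⊥-elim (l≢l' refl)

  Star⇒quartet-medians : ∀ {A B C D s y} → Star A B C D s → MedianOf3 (InQuartet A B C D) y → y ≡ s
  Star⇒quartet-medians σ μ = median-unique median₁₂₃ (Star⇒∈p σ U₁ U₂ l₁≢l₂ , Star⇒∈p σ U₁ U₃ l₁≢l₃ , Star⇒∈p σ U₂ U₃ l₂≢l₃)
    where open MedianOf3 μ

  private
    quartet-path-from-A : ∀ {A B C D s t l q} → Resolved A B C D s t →
      InQuartet A B C D l → q ∈ p A l → q ∈ p A B ⊎ q ∈ p s C ⊎ q ∈ p s D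
    quartet-path-from-A {A} {B} {q = q} τ (inj₁ refl) q∈ with subst (q ∈_) (p-refl A) q∈
    ... | here refl = inj₁ (source∈p A B)
    quartet-path-from-A τ (inj₂ (inj₁ refl)) q∈ = inj₁ q∈
    quartet-path-from-A τ (inj₂ (inj₂ (inj₁ refl))) q∈ =
      Data.Sum.map (∈p-left⇒∈p (Resolved.sAB τ)) inj₁ (∈p-split (Resolved.sAC τ) q∈)
    quartet-path-from-A τ (inj₂ (inj₂ (inj₂ refl))) q∈ =
      Data.Sum.map (∈p-left⇒∈p (Resolved.sAB τ)) inj₂ (∈p-split (Resolved.sAD τ) q∈)

  quartet-path-location : ∀ {A B C D s t l₁ l₂ q} → Resolved A B C D s t →
    InQuartet A B C D l₁ → InQuartet A B C D l₂ → q ∈ p l₁ l₂ → q ∈ p A B ⊎ q ∈ p s C ⊎ q ∈ p s D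
  quartet-path-location τ Ql₁ Ql₂ q∈ =
    Data.Sum.[ quartet-path-from-A τ Ql₁ , quartet-path-from-A τ Ql₂ ] (∈p-triangle q∈)

module Separation {ℝ : RealField} {m : ℕ} (T : WTree ℝ m)
         (essential : TreeDefs.Essential T) (internal-positive : TreeDefs.InternalPositive T) where
  open WTree T
  open TreeDefs T
  open TreePaths T
  open InternalPositiveTree T essential internal-positive
  open Quartets T
  open RealFieldProperties ℝ

  -- x leaves the path from s to c at g ≢ s while a and b branch off at s, so the difference for b
  -- exceeds the one for c by 2 D(s,g)
  branching-apart⇒differences-differ : ∀ {x a b c s g} → ¬ IsLeaf s → ¬ IsLeaf g → g ≢ s →
    g ∈ p x s → s ∈ p g b → s ∈ p a b → g ∈ p x c → s ∈ p a c → g ∈ p s c →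
    ¬ (D x b - D a b ≈ D x c - D a c)
  branching-apart⇒differences-differ {x} {a} {b} {c} {s} {g} ¬leaf-s ¬leaf-g g≢s gxs sgb sab gxc sac gsc eq =
    x≈y+z⇒x≉y (+-pos (D-pos ¬leaf-g ¬leaf-s g≢s) (D-pos ¬leaf-s ¬leaf-g (≢-sym g≢s))) gap (x-y≈z-w⇒x+w≈z+y eq)
    where
    open SetoidReasoning setoid
    gap : D x b + D a c ≈ (D x c + D a b) + (D g s + D s g)
    gap = begin
      D x b + D a c                                           ≈⟨ +-cong (≈-trans (D-split (∈p-extendʳ gxs sgb g≢s)) (+-congˡ (D-split sgb)))
                                                                         (≈-trans (D-split sac) (+-congˡ (D-split gsc))) ⟩
      (D x g + (D g s + D s b)) + (D a s + (D s g + D g c))   ≈⟨ solve 6 (λ xg gs sb as sg gc →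
                                                                   (xg :+ (gs :+ sb)) :+ (as :+ (sg :+ gc))
                                                                := ((xg :+ gc) :+ (as :+ sb)) :+ (gs :+ sg)) ≈-refl
                                                                   (D x g) (D g s) (D s b) (D a s) (D s g) (D g c) ⟩
      ((D x g + D g c) + (D a s + D s b)) + (D g s + D s g)   ≈⟨ +-congʳ (+-cong (D-split gxc) (D-split sab)) ⟨
      (D x c + D a b) + (D g s + D s g)                       ∎

  attached-inside-bridge⇒differences-differ : ∀ {a b c d s t x v} → Resolved a b c d s t → ¬ IsLeaf s →
    v ∈ p s t → v ≢ s → v ≢ t → v ∈ p x s → v ∈ p x t → ¬ (D x b - D a b ≈ D x c - D a c)
  attached-inside-bridge⇒differences-differ τ ¬leaf-s vst v≢s v≢t vxs vxt =
    branching-apart⇒differences-differ ¬leaf-s (interior⇒¬IsLeaf vst v≢s v≢t) v≢s vxs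
      (∈p-shrinkˡ (s∈p-t-B τ) (∈p-sym vst)) sAB (∈p-extendʳ vxt (∈p-shrinkˡ (t∈p-s-C τ) vst) v≢t)
      sAC (∈p-left⇒∈p (t∈p-s-C τ) vst)
    where open Resolved τ

  attached-off-stalk⇒differences-differ : ∀ {a b c d s t x q} → Resolved a b c d s t → ¬ IsLeaf s →
    IsLeaf x → IsLeaf c → x ≢ c → q ∈ p x s → q ∈ p s c → q ≢ s → ¬ (D x b - D a b ≈ D x c - D a c)
  attached-off-stalk⇒differences-differ {b = b} {c} {s = s} {x = x} {q} τ ¬leaf-s leaf-x leaf-c x≢c qxs qsc q≢s with median x _ _
  ... | h , (hxs , hxc , hsc) =
    branching-apart⇒differences-differ ¬leaf-s (interior⇒¬IsLeaf hxc h≢x h≢c) h≢s hxs (∈p-shrinkˡ sxb hxs) sAB hxc sAC hsc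
    where
    open Resolved τ
    h≢s : h ≢ s
    h≢s refl = q≢s (∈p-left∩right hxc qxs qsc)
    h≢x : h ≢ x
    h≢x refl with IsLeaf∈p⇒endpoint leaf-x hsc
    ... | inj₁ refl = ¬leaf-s leaf-x
    ... | inj₂ x≡c = x≢c x≡c
    h≢c : h ≢ c
    h≢c refl with IsLeaf∈p⇒endpoint leaf-c hxs
    ... | inj₁ c≡x = x≢c (sym c≡x)
    ... | inj₂ refl = ¬leaf-s leaf-c
    sxb : s ∈ p x b
    sxb = ∈p-extendˡ qxs (∈p-shrinkˡ (∈p-sym sBC) (∈p-sym qsc)) q≢s

  stalk-on-attachment-path : ∀ {a b c d s t x r q} → Resolved a b c d s t → IsMedian r x a b →
    q ∈ p x r → q ∈ p s c → s ≡ r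
  stalk-on-attachment-path {s = s} {r = r} {q} τ mr@(_ , _ , rab) qxr qsc = ∈p-to-median⇒≡ mr (∈p-right⇒∈p qxr s∈qr) sAB
    where
    open Resolved τ
    s∈qr : s ∈ p q r
    s∈qr with ∈p-split sAB rab
    ... | inj₁ k = ∈p-shrinkʳ (∈p-shrinkˡ (∈p-sym sAC) (∈p-sym qsc)) (∈p-sym k)
    ... | inj₂ k = ∈p-shrinkʳ (∈p-shrinkˡ (∈p-sym sBC) (∈p-sym qsc)) k

  meets-quartet-early⇒differences-differ : ∀ {a b c d s t x r q} → Resolved a b c d s t → ¬ IsLeaf s →
    IsLeaf x → IsLeaf c → IsLeaf d → x ≢ c → x ≢ d → IsMedian r x a b → q ∈ p x r → q ≢ r →
    q ∈ p a b ⊎ q ∈ p s c ⊎ q ∈ p s d →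
    D x b - D a b ≈ D x c - D a c → D x b - D a b ≈ D x d - D a d → ⊥
  meets-quartet-early⇒differences-differ τ ¬leaf-s leaf-x leaf-c leaf-d x≢c x≢d mr qxr q≢r (inj₁ qab) _ _ =
    q≢r (∈p-to-median⇒≡ mr qxr qab)
  meets-quartet-early⇒differences-differ τ ¬leaf-s leaf-x leaf-c leaf-d x≢c x≢d mr qxr q≢r (inj₂ (inj₁ qsc)) eq _
    with stalk-on-attachment-path τ mr qxr qsc
  ... | refl = attached-off-stalk⇒differences-differ τ ¬leaf-s leaf-x leaf-c x≢c qxr qsc q≢r eq
  meets-quartet-early⇒differences-differ τ ¬leaf-s leaf-x leaf-c leaf-d x≢c x≢d mr qxr q≢r (inj₂ (inj₂ qsd)) _ eq
    with stalk-on-attachment-path (Resolved-swapʳ τ) mr qxr qsd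
  ... | refl = attached-off-stalk⇒differences-differ (Resolved-swapʳ τ) ¬leaf-s leaf-x leaf-d x≢d qxr qsd q≢r eq

  Resolved⇒0<2D : ∀ {a b c d s t} → Resolved a b c d s t → a ≢ b → a ≢ c → b ≢ c → c ≢ d → a ≢ d →
                  0# < D s t + D s t
  Resolved⇒0<2D {s = s} {t} τ a≢b a≢c b≢c c≢d a≢d = +-pos 0<D 0<D
    where
    0<D : 0# < D s t
    0<D = D-pos (median-of-distinct⇒¬IsLeaf a≢b a≢c b≢c (stalk-medianˡ τ))
                (median-of-distinct⇒¬IsLeaf c≢d (≢-sym a≢c) (≢-sym a≢d) (stalk-medianʳ τ))
                (Resolved.s≢t τ)

-- Leaf-labelled quartets

module LabelledLeaves {ℝ : RealField} {m n : ℕ} (T : WTree ℝ m) (leaf : Fin n → Fin m)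
         (labels : LeafDefs.LeafSet T leaf) where
  open TreeDefs T
  open TreePaths T
  open LeafDefs T leaf
  open RealFieldProperties ℝ

  leaf-≢ : ∀ {i j} → i ≢ j → leaf i ≢ leaf j
  leaf-≢ i≢j e = i≢j (proj₁ labels _ _ e)

  IsLeaf-leaf : ∀ i → IsLeaf (leaf i)
  IsLeaf-leaf = proj₁ (proj₂ labels)

  ConstDiff-refl : ∀ {x z₁ z₂ z₃} → ConstDiff x x z₁ z₂ z₃
  ConstDiff-refl {x} z z' _ _ = ≈-trans (-‿inverseʳ (S x z)) (≈-sym (-‿inverseʳ (S x z')))

  -- when r lies on the paths from x and from y to every z, S x z − S y z = D x r − D y r
  ConstDiff-via : ∀ {x y z₁ z₂ z₃} r →
    (∀ z → z ≡ z₁ ⊎ z ≡ z₂ ⊎ z ≡ z₃ → r ∈ p (leaf x) (leaf z) × r ∈ p (leaf y) (leaf z)) → ConstDiff x y z₁ z₂ z₃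
  ConstDiff-via {x} {y} r through-r z z' (z∈ , _) (z'∈ , _) =
    ≈-trans (via-r (through-r z z∈)) (≈-sym (via-r (through-r z' z'∈)))
    where
    via-r : ∀ {z} → r ∈ p (leaf x) (leaf z) × r ∈ p (leaf y) (leaf z) → S x z - S y z ≈ D (leaf x) r - D (leaf y) r
    via-r {z} (rxz , ryz) = x+w≈z+y⇒x-y≈z-w (≈-trans (+-cong (D-split rxz) ≈-refl)
      (≈-trans (solve 4 (λ xr rz yr yz → (xr :+ rz) :+ yr := xr :+ (yr :+ rz)) ≈-refl
                  (D (leaf x) r) (D r (leaf z)) (D (leaf y) r) (D (leaf y) (leaf z)))
        (+-congˡ (≈-sym (D-split ryz)))))

module LabelledQuartet {ℝ : RealField} {m n : ℕ} (T : WTree ℝ m) (leaf : Fin n → Fin m)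
         (essential : TreeDefs.Essential T) (internal-positive : TreeDefs.InternalPositive T)
         (labels : LeafDefs.LeafSet T leaf)
         (a b c d : Fin n) (a≢b : a ≢ b) (a≢c : a ≢ c) (a≢d : a ≢ d) (b≢c : b ≢ c) (b≢d : b ≢ d) (c≢d : c ≢ d) where
  open WTree T
  open TreeDefs T
  open TreePaths T
  open MinimalSubtrees T
  open InternalPositiveTree T essential internal-positive
  open Quartets T
  open Separation T essential internal-positive
  open LabelledLeaves T leaf labels
  open LeafDefs T leaf hiding (LeafSet)

  Q : V → Set
  Q = Quad a b c d

  Q⇒IsLeaf : ∀ {v} → Q v → IsLeaf v
  Q⇒IsLeaf (inj₁ refl)               = IsLeaf-leaf a
  Q⇒IsLeaf (inj₂ (inj₁ refl))        = IsLeaf-leaf b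
  Q⇒IsLeaf (inj₂ (inj₂ (inj₁ refl))) = IsLeaf-leaf c
  Q⇒IsLeaf (inj₂ (inj₂ (inj₂ refl))) = IsLeaf-leaf d

  qa : Q (leaf a)
  qa = inj₁ refl
  qb : Q (leaf b)
  qb = inj₂ (inj₁ refl)
  qc : Q (leaf c)
  qc = inj₂ (inj₂ (inj₁ refl))
  qd : Q (leaf d)
  qd = inj₂ (inj₂ (inj₂ refl))

  stalks-SubNode : ∀ {X₁ X₂ X₃ X₄ s t} → Resolved X₁ X₂ X₃ X₄ s t → Q X₁ → Q X₂ → Q X₃ → Q X₄ →
    X₁ ≢ X₂ → X₁ ≢ X₃ → X₂ ≢ X₃ → X₃ ≢ X₄ → X₁ ≢ X₄ → SubNode Q s × SubNode Q t
  stalks-SubNode τ q₁ q₂ q₃ q₄ X₁≢X₂ X₁≢X₃ X₂≢X₃ X₃≢X₄ X₁≢X₄ =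
      median-of-leaves⇒SubNode (Q⇒IsLeaf q₁) (Q⇒IsLeaf q₂) (Q⇒IsLeaf q₃) X₁≢X₂ X₁≢X₃ X₂≢X₃ q₁ q₂ q₃ (stalk-medianˡ τ)
    , median-of-leaves⇒SubNode (Q⇒IsLeaf q₃) (Q⇒IsLeaf q₄) (Q⇒IsLeaf q₁) X₃≢X₄ (≢-sym X₁≢X₃) (≢-sym X₁≢X₄) q₃ q₄ q₁
        (stalk-medianʳ τ)

  A≢B : leaf a ≢ leaf b
  A≢B = leaf-≢ a≢b
  A≢C : leaf a ≢ leaf c
  A≢C = leaf-≢ a≢c
  A≢D : leaf a ≢ leaf d
  A≢D = leaf-≢ a≢d
  B≢C : leaf b ≢ leaf c
  B≢C = leaf-≢ b≢c
  B≢D : leaf b ≢ leaf d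
  B≢D = leaf-≢ b≢d
  C≢D : leaf c ≢ leaf d
  C≢D = leaf-≢ c≢d

  ResolvedQuartet : V → V → Set
  ResolvedQuartet = Resolved (leaf a) (leaf b) (leaf c) (leaf d)

  module _ {s t} (τ : ResolvedQuartet s t) where
    open Resolved τ

    stalk-SubNodes : SubNode Q s × SubNode Q t
    stalk-SubNodes = stalks-SubNode τ qa qb qc qd A≢B A≢C B≢C C≢D A≢D

    ¬IsLeaf-s : ¬ IsLeaf s
    ¬IsLeaf-s = median-of-distinct⇒¬IsLeaf A≢B A≢C B≢C (stalk-medianˡ τ)

    ¬IsLeaf-t : ¬ IsLeaf t
    ¬IsLeaf-t = median-of-distinct⇒¬IsLeaf C≢D (≢-sym A≢C) (≢-sym A≢D) (stalk-medianʳ τ)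

    SubNode-on-ab⇒≡s : ∀ {y} → y ∈ p (leaf a) (leaf b) → SubNode Q y → y ≡ s
    SubNode-on-ab⇒≡s y∈ sn with Resolved⇒quartet-medians τ (SubNode⇒MedianOf3 sn)
    ... | inj₁ y≡s = y≡s
    ... | inj₂ refl = ⊥-elim (s≢t (median-unique (stalk-medianˡ τ) (y∈ , tAC , tBC)))

    SubNode-on-cd⇒≡t : ∀ {y} → y ∈ p (leaf c) (leaf d) → SubNode Q y → y ≡ t
    SubNode-on-cd⇒≡t y∈ sn with Resolved⇒quartet-medians τ (SubNode⇒MedianOf3 sn)
    ... | inj₂ y≡t = y≡t
    ... | inj₁ refl = ⊥-elim (s≢t (median-unique (y∈ , ∈p-sym sAC , ∈p-sym sAD) (stalk-medianʳ τ)))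

    Resolved⇒Split : Split a b c d
    Resolved⇒Split =
        (s , sAB , proj₁ stalk-SubNodes , λ _ → SubNode-on-ab⇒≡s)
      , (t , tCD , proj₂ stalk-SubNodes , λ _ → SubNode-on-cd⇒≡t)
      , λ { (_ , _ , _ , only) → s≢t (trans (only s sAC (proj₁ stalk-SubNodes)) (sym (only t tAC (proj₂ stalk-SubNodes)))) }

    BridgeOneEdge⇒length≡2 : BridgeOneEdge a b c d → length (p s t) ≡ 2
    BridgeOneEdge⇒length≡2 (_ , _ , (s'∈ , sn) , (t'∈ , tn) , length≡2)
      with SubNode-on-ab⇒≡s s'∈ sn | SubNode-on-cd⇒≡t t'∈ tn
    ... | refl | refl = length≡2

    length≡2⇒BridgeOneEdge : length (p s t) ≡ 2 → BridgeOneEdge a b c d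
    length≡2⇒BridgeOneEdge length≡2 = s , t , (sAB , proj₁ stalk-SubNodes) , (tCD , proj₂ stalk-SubNodes) , length≡2

  private
    stalks-on-ab⇒¬Neighbours : ∀ {X₂ X₄ s t} → Resolved (leaf a) X₂ (leaf b) X₄ s t → SubNode Q s × SubNode Q t →
                               ¬ Neighbours Q (leaf a) (leaf b)
    stalks-on-ab⇒¬Neighbours τ (s-node , t-node) (_ , _ , _ , only) =
      Resolved.s≢t τ (trans (only _ (Resolved.sAC τ) s-node) (sym (only _ (Resolved.tAC τ) t-node)))

  Split⇒Resolved : Split a b c d → Σ V λ s → Σ V λ t → ResolvedQuartet s t
  Split⇒Resolved (ab , _ , ¬ac) with shape (leaf a) (leaf b) (leaf c) (leaf d)
  ... | ab∣cd s t τ = s , t , τ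
  ... | star s σ = ⊥-elim (¬ac (s , sAC , s-SubNode , λ _ _ sn → Star⇒quartet-medians σ (SubNode⇒MedianOf3 sn)))
    where
    open Star σ
    s-SubNode : SubNode Q s
    s-SubNode = median-of-leaves⇒SubNode (IsLeaf-leaf a) (IsLeaf-leaf b) (IsLeaf-leaf c) A≢B A≢C B≢C qa qb qc (sAB , sAC , sBC)
  ... | ac∣bd s t τ = ⊥-elim (stalks-on-ab⇒¬Neighbours τ (stalks-SubNode τ qa qc qb qd A≢C A≢B (≢-sym B≢C) B≢D A≢D) ab)
  ... | ad∣bc s t τ = ⊥-elim (stalks-on-ab⇒¬Neighbours τ (stalks-SubNode τ qa qd qb qc A≢D A≢B (≢-sym B≢D) B≢C A≢C) ab)

  module Attachment {s t} (τ : ResolvedQuartet s t) (x : Fin n) (x≢a : x ≢ a) (x≢b : x ≢ b) (x≢c : x ≢ c) (x≢d : x ≢ d) where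
    open Resolved τ

    X : V
    X = leaf x

    r : V
    r = proj₁ (median X (leaf a) (leaf b))

    rXA : r ∈ p X (leaf a)
    rXA = proj₁ (proj₂ (median X (leaf a) (leaf b)))
    rXB : r ∈ p X (leaf b)
    rXB = proj₁ (proj₂ (proj₂ (median X (leaf a) (leaf b))))
    rAB : r ∈ p (leaf a) (leaf b)
    rAB = proj₂ (proj₂ (proj₂ (median X (leaf a) (leaf b))))

    r-on-path-to : ∀ {u} → u ∈ p (leaf a) (leaf b) → r ∈ p X u
    r-on-path-to u∈ with ∈p-split rAB u∈
    ... | inj₁ k = ∈p-shrinkʳ rXA (∈p-sym k)
    ... | inj₂ k = ∈p-shrinkʳ rXB k

    -- r is where x attaches to p(a,b); x clings to it iff the path from x to r avoids A|{a,b,c,d}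
    Avoids : Set
    Avoids = ∀ {y z} → EdgeOn (p X r) y z → ¬ SubE Q y z

    vertex-before-attachment : ∀ {y z l₁ l₂} → EdgeOn (p X r) y z → EdgeOn (p l₁ l₂) y z →
                               Σ V λ q → q ∈ p X r × q ≢ r × q ∈ p l₁ l₂
    vertex-before-attachment {y} {z} e e' with y ≟ r
    ... | yes refl = z , proj₂ (EdgeOn-p⇒∈p e) , (λ z≡r → EdgeOn-p⇒≢ e (sym z≡r)) , proj₂ (EdgeOn-p⇒∈p e')
    ... | no y≢r = y , proj₁ (EdgeOn-p⇒∈p e) , y≢r , proj₁ (EdgeOn-p⇒∈p e')

    ConstDiff⇒Avoids : ConstDiff x a b c d ⊎ ConstDiff x b a c d → Avoids
    ConstDiff⇒Avoids const e (_ , _ , Ql₁ , Ql₂ , e') with vertex-before-attachment e e' | const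
    ... | q , qXr , q≢r , q∈ | inj₁ const-a =
      meets-quartet-early⇒differences-differ τ (¬IsLeaf-s τ) (IsLeaf-leaf x) (IsLeaf-leaf c) (IsLeaf-leaf d)
        (leaf-≢ x≢c) (leaf-≢ x≢d) (rXA , rXB , rAB) qXr q≢r (quartet-path-location τ Ql₁ Ql₂ q∈)
        (const-a b c (inj₁ refl , ≢-sym x≢b) (inj₂ (inj₁ refl) , ≢-sym x≢c))
        (const-a b d (inj₁ refl , ≢-sym x≢b) (inj₂ (inj₂ refl) , ≢-sym x≢d))
    ... | q , qXr , q≢r , q∈ | inj₂ const-b =
      meets-quartet-early⇒differences-differ (Resolved-swapˡ τ) (¬IsLeaf-s τ) (IsLeaf-leaf x) (IsLeaf-leaf c) (IsLeaf-leaf d)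
        (leaf-≢ x≢c) (leaf-≢ x≢d) (rXB , rXA , ∈p-sym rAB) qXr q≢r
        (Data.Sum.map₁ ∈p-sym (quartet-path-location τ Ql₁ Ql₂ q∈))
        (const-b a c (inj₁ refl , ≢-sym x≢a) (inj₂ (inj₁ refl) , ≢-sym x≢c))
        (const-b a d (inj₁ refl , ≢-sym x≢a) (inj₂ (inj₂ refl) , ≢-sym x≢d))

    Clings⇒Avoids : Clings a b c d x → Avoids
    Clings⇒Avoids clings e e-in-Q with clings _ _ (X , r , inj₂ refl , inj₁ rAB , e) e-in-Q
    ... | e-on-ab = EdgeOn-p⇒≢ e (trans (∈p-to-median⇒≡ mr (proj₁ (EdgeOn-p⇒∈p e)) (proj₁ (EdgeOn-p⇒∈p e-on-ab)))
                                        (sym (∈p-to-median⇒≡ mr (proj₂ (EdgeOn-p⇒∈p e)) (proj₂ (EdgeOn-p⇒∈p e-on-ab)))))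
      where
      mr : IsMedian r X (leaf a) (leaf b)
      mr = rXA , rXB , rAB

    Avoids⇒Clings : Avoids → Clings a b c d x
    Avoids⇒Clings avoids y z (_ , _ , inj₁ u₁∈ , inj₁ u₂∈ , e) _ = EdgeOn-subpath u₁∈ u₂∈ e
    Avoids⇒Clings avoids y z (_ , _ , inj₂ refl , inj₁ u∈ , e) e-in-Q = from-X u∈ e e-in-Q
      where
      from-X : ∀ {u y z} → u ∈ p (leaf a) (leaf b) → EdgeOn (p X u) y z → SubE Q y z → EdgeOn (p (leaf a) (leaf b)) y z
      from-X u∈ e e-in-Q with EdgeOn-split (r-on-path-to u∈) e
      ... | inj₁ e-before-r = ⊥-elim (avoids e-before-r e-in-Q)
      ... | inj₂ e-after-r = EdgeOn-subpath rAB u∈ e-after-r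
    Avoids⇒Clings avoids y z (u₁ , u₂ , inj₁ u∈ , inj₂ refl , e) e-in-Q =
      Avoids⇒Clings avoids y z (u₂ , u₁ , inj₂ refl , inj₁ u∈ , EdgeOn-p-sym e) e-in-Q
    Avoids⇒Clings avoids y z (_ , _ , inj₂ refl , inj₂ refl , e) _ = ⊥-elim (¬EdgeOn-p-refl e)

    Avoids⇒r∈p : ∀ {l₁ l} → Avoids → Q l₁ → Q l → r ∈ p l₁ l → r ∈ p X l
    Avoids⇒r∈p {l₁} {l} avoids Ql₁ Ql r∈ = meet-only-at⇒∈p meet
      where
      meet : ∀ {q} → q ∈ p X r → q ∈ p r l → q ≡ r
      meet {q} q∈Xr q∈rl with q ≟ r
      ... | yes q≡r = q≡r
      ... | no q≢r with first-step (≢-sym q≢r)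
      ... | k , r→k = ⊥-elim (avoids (EdgeOn-right⇒EdgeOn q∈Xr (EdgeOn-p-sym edge))
                                     (l₁ , l , Ql₁ , Ql , EdgeOn-right⇒EdgeOn r∈ (EdgeOn-left⇒EdgeOn q∈rl edge)))
        where
        edge : EdgeOn (p r q) r k
        edge = inj₁ (FirstStep⇒Consec r→k)

    attachment-on-paths⇒ConstDiff :
      (r ∈ p (leaf a) s → r ∈ p X (leaf c) × r ∈ p X (leaf d)) →
      (r ∈ p s (leaf b) → r ∈ p X (leaf c) × r ∈ p X (leaf d)) → ConstDiff x a b c d ⊎ ConstDiff x b a c d
    attachment-on-paths⇒ConstDiff via-a via-b with ∈p-split sAB rAB
    ... | inj₁ r∈as = inj₁ (ConstDiff-via r through-r)
      where
      through-r : ∀ z → z ≡ b ⊎ z ≡ c ⊎ z ≡ d → r ∈ p X (leaf z) × r ∈ p (leaf a) (leaf z)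
      through-r _ (inj₁ refl)        = rXB , rAB
      through-r _ (inj₂ (inj₁ refl)) = proj₁ (via-a r∈as) , ∈p-left⇒∈p sAC r∈as
      through-r _ (inj₂ (inj₂ refl)) = proj₂ (via-a r∈as) , ∈p-left⇒∈p sAD r∈as
    ... | inj₂ r∈sb = inj₂ (ConstDiff-via r through-r)
      where
      through-r : ∀ z → z ≡ a ⊎ z ≡ c ⊎ z ≡ d → r ∈ p X (leaf z) × r ∈ p (leaf b) (leaf z)
      through-r _ (inj₁ refl)        = rXA , ∈p-sym rAB
      through-r _ (inj₂ (inj₁ refl)) = proj₁ (via-b r∈sb) , ∈p-left⇒∈p sBC (∈p-sym r∈sb)
      through-r _ (inj₂ (inj₂ refl)) = proj₂ (via-b r∈sb) , ∈p-left⇒∈p sBD (∈p-sym r∈sb)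

    Avoids⇒ConstDiff : Avoids → ConstDiff x a b c d ⊎ ConstDiff x b a c d
    Avoids⇒ConstDiff avoids = attachment-on-paths⇒ConstDiff
      (λ r∈as → Avoids⇒r∈p avoids qa qc (∈p-left⇒∈p sAC r∈as) , Avoids⇒r∈p avoids qa qd (∈p-left⇒∈p sAD r∈as))
      (λ r∈sb → Avoids⇒r∈p avoids qb qc (∈p-left⇒∈p sBC (∈p-sym r∈sb)) , Avoids⇒r∈p avoids qb qd (∈p-left⇒∈p sBD (∈p-sym r∈sb)))

    s∈p-X-t⇒ConstDiff : s ∈ p X t → ConstDiff x a b c d ⊎ ConstDiff x b a c d
    s∈p-X-t⇒ConstDiff sXt = attachment-on-paths⇒ConstDiff
      (λ r∈as → towards-cd (∈p-shrinkʳ rXB (∈p-shrinkˡ sAB r∈as)))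
      (λ r∈sb → towards-cd (∈p-shrinkʳ rXA (∈p-shrinkˡ (∈p-sym sAB) (∈p-sym r∈sb))))
      where
      towards-cd : r ∈ p X s → r ∈ p X (leaf c) × r ∈ p X (leaf d)
      towards-cd rXs = ∈p-left⇒∈p (∈p-extendʳ sXt (t∈p-s-C τ) s≢t) rXs , ∈p-left⇒∈p (∈p-extendʳ sXt (t∈p-s-D τ) s≢t) rXs

  InL⇔Clings : ∀ {s t} → ResolvedQuartet s t → ∀ x →
    (InL a b c d x × x ≢ a × x ≢ b) ⇔ ((x ≢ a × x ≢ b × x ≢ c × x ≢ d) × Clings a b c d x)
  InL⇔Clings τ x = mk⇔
    (λ { ((x≢c , x≢d , const) , x≢a , x≢b) →
         (x≢a , x≢b , x≢c , x≢d) , Equivalence.to (ConstDiff⇔Clings x≢a x≢b x≢c x≢d) const })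
    (λ { ((x≢a , x≢b , x≢c , x≢d) , clings) →
         (x≢c , x≢d , Equivalence.from (ConstDiff⇔Clings x≢a x≢b x≢c x≢d) clings) , x≢a , x≢b })
    where
    ConstDiff⇔Clings : x ≢ a → x ≢ b → x ≢ c → x ≢ d → (ConstDiff x a b c d ⊎ ConstDiff x b a c d) ⇔ Clings a b c d x
    ConstDiff⇔Clings x≢a x≢b x≢c x≢d = mk⇔ (Avoids⇒Clings ∘ ConstDiff⇒Avoids) (Avoids⇒ConstDiff ∘ Clings⇒Avoids)
      where open Attachment τ x x≢a x≢b x≢c x≢d

module Proposition {ℝ : RealField} {m n : ℕ} (T : WTree ℝ m) (leaf : Fin n → Fin m)
         (essential : TreeDefs.Essential T) (internal-positive : TreeDefs.InternalPositive T)
         (labels : LeafDefs.LeafSet T leaf)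
         (a b c d : Fin n) (a≢b : a ≢ b) (a≢c : a ≢ c) (a≢d : a ≢ d) (b≢c : b ≢ c) (b≢d : b ≢ d) (c≢d : c ≢ d) where
  open WTree T
  open TreeDefs T
  open TreePaths T
  open InternalPositiveTree T essential internal-positive
  open Quartets T
  open Separation T essential internal-positive
  open LabelledLeaves T leaf labels
  open LeafDefs T leaf hiding (LeafSet)
  open RealFieldProperties ℝ
  open LabelledQuartet T leaf essential internal-positive labels a b c d a≢b a≢c a≢d b≢c b≢d c≢d
  module Opposite = LabelledQuartet T leaf essential internal-positive labels c d a b
                      c≢d (≢-sym a≢c) (≢-sym b≢c) (≢-sym a≢d) (≢-sym b≢d) a≢b

  L-characterisations : Split a b c d →
    (∀ x → (InL a b c d x × x ≢ a × x ≢ b) ⇔ ((x ≢ a × x ≢ b × x ≢ c × x ≢ d) × Clings a b c d x)) ×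
    (∀ x → (InL c d a b x × x ≢ c × x ≢ d) ⇔ ((x ≢ a × x ≢ b × x ≢ c × x ≢ d) × Clings c d a b x))
  L-characterisations split with Split⇒Resolved split
  ... | s , t , τ = InL⇔Clings τ , λ x → reorder (Opposite.InL⇔Clings (Resolved-flip τ) x)
    where
    reorder : ∀ {P R : Set} {x : Fin n} → P ⇔ ((x ≢ c × x ≢ d × x ≢ a × x ≢ b) × R) → P ⇔ ((x ≢ a × x ≢ b × x ≢ c × x ≢ d) × R)
    reorder P⇔ = mk⇔
      (λ P → let ((x≢c , x≢d , x≢a , x≢b) , R) = Equivalence.to P⇔ P in (x≢a , x≢b , x≢c , x≢d) , R)
      (λ { ((x≢a , x≢b , x≢c , x≢d) , R) → Equivalence.from P⇔ ((x≢c , x≢d , x≢a , x≢b) , R) })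

  Covering : Set
  Covering = ∀ x → InL a b c d x ⊎ InL c d a b x

  one-edge-bridge⇒Covering : ∀ {s t} → ResolvedQuartet s t → length (p s t) ≡ 2 → Covering
  one-edge-bridge⇒Covering {s} {t} τ length≡2 x with x ≟ a | x ≟ b | x ≟ c | x ≟ d
  ... | yes refl | _ | _ | _ = inj₁ (a≢c , a≢d , inj₁ ConstDiff-refl)
  ... | no _ | yes refl | _ | _ = inj₁ (b≢c , b≢d , inj₂ ConstDiff-refl)
  ... | no _ | no _ | yes refl | _ = inj₂ (≢-sym a≢c , ≢-sym b≢c , inj₁ ConstDiff-refl)
  ... | no _ | no _ | no _ | yes refl = inj₂ (≢-sym a≢d , ≢-sym b≢d , inj₂ ConstDiff-refl)
  ... | no x≢a | no x≢b | no x≢c | no x≢d with median (leaf x) s t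
  ...   | g , (gXs , gXt , gst) with length≡2⇒endpoints (Resolved.s≢t τ) length≡2 gst
  ...     | inj₁ refl = inj₁ (x≢c , x≢d , Attachment.s∈p-X-t⇒ConstDiff τ x x≢a x≢b x≢c x≢d gXt)
  ...     | inj₂ refl = inj₂ (x≢a , x≢b , Opposite.Attachment.s∈p-X-t⇒ConstDiff (Resolved-flip τ) x x≢c x≢d x≢a x≢b gXs)

  attached-inside-bridge⇒uncovered : ∀ {s t v} → ResolvedQuartet s t → v ∈ p s t → v ≢ s → v ≢ t →
    ∀ x → v ∈ p (leaf x) s → v ∈ p (leaf x) t → ¬ (InL a b c d x ⊎ InL c d a b x)
  attached-inside-bridge⇒uncovered τ vst v≢s v≢t x vXs vXt = outside
    where
    x≢a : x ≢ a
    x≢a refl = v≢s (∈p-left∩right (∈p-sym (s∈p-t-A τ)) vXs vst)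
    x≢b : x ≢ b
    x≢b refl = v≢s (∈p-left∩right (∈p-sym (s∈p-t-B τ)) vXs vst)
    x≢c : x ≢ c
    x≢c refl = v≢t (∈p-left∩right (t∈p-s-C τ) vst (∈p-sym vXt))
    x≢d : x ≢ d
    x≢d refl = v≢t (∈p-left∩right (t∈p-s-D τ) vst (∈p-sym vXt))
    outside : ¬ (InL a b c d x ⊎ InL c d a b x)
    outside (inj₁ (_ , _ , inj₁ const)) =
      attached-inside-bridge⇒differences-differ τ (¬IsLeaf-s τ) vst v≢s v≢t vXs vXt
        (const b c (inj₁ refl , ≢-sym x≢b) (inj₂ (inj₁ refl) , ≢-sym x≢c))
    outside (inj₁ (_ , _ , inj₂ const)) =
      attached-inside-bridge⇒differences-differ (Resolved-swapˡ τ) (¬IsLeaf-s τ) vst v≢s v≢t vXs vXt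
        (const a c (inj₁ refl , ≢-sym x≢a) (inj₂ (inj₁ refl) , ≢-sym x≢c))
    outside (inj₂ (_ , _ , inj₁ const)) =
      attached-inside-bridge⇒differences-differ (Resolved-flip τ) (¬IsLeaf-t τ) (∈p-sym vst) v≢t v≢s vXt vXs
        (const d a (inj₁ refl , ≢-sym x≢d) (inj₂ (inj₁ refl) , ≢-sym x≢a))
    outside (inj₂ (_ , _ , inj₂ const)) =
      attached-inside-bridge⇒differences-differ (Resolved-swapˡ (Resolved-flip τ)) (¬IsLeaf-t τ) (∈p-sym vst) v≢t v≢s vXt vXs
        (const c a (inj₁ refl , ≢-sym x≢c) (inj₂ (inj₁ refl) , ≢-sym x≢a))

  -- an interior vertex of a longer bridge has a third neighbour (the tree is essential),
  -- behind which hangs a leaf attached at that vertex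
  long-bridge⇒¬Covering : ∀ {s t} → ResolvedQuartet s t → ¬ (length (p s t) ≡ 2) → ¬ Covering
  long-bridge⇒¬Covering {s} {t} τ length≢2 covering with first-step (Resolved.s≢t τ)
  ... | v , [] , e = length≢2 (cong length e)
  ... | v , k ∷ rest , e = essential v (u₁ , u₂ , u₁≢u₂ , FirstStep⇒Adj v→s , FirstStep⇒Adj v→t , only-two)
    where
    vst : v ∈ p s t
    vst = subst (v ∈_) (sym e) (there (here refl))
    v≢s : v ≢ s
    v≢s = ≢-sym (FirstStep⇒≢ (k ∷ rest , e))
    v≢t : v ≢ t
    v≢t = Consec-p⇒≢target (subst (λ q → Consec q v k) (sym e) (there here))
    u₁ : V
    u₁ = proj₁ (first-step v≢s)
    v→s : FirstStep v s u₁
    v→s = proj₂ (first-step v≢s)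
    u₂ : V
    u₂ = proj₁ (first-step v≢t)
    v→t : FirstStep v t u₂
    v→t = proj₂ (first-step v≢t)
    u₁≢u₂ : u₁ ≢ u₂
    u₁≢u₂ = ∈p⇒distinct-first-steps vst v→s v→t
    no-third-neighbour : ∀ u → Adj v u → u ≢ u₁ → u ≢ u₂ → ⊥
    no-third-neighbour u vu u≢u₁ u≢u₂ with leaf-beyond vu
    ... | l , leaf-l , v→l with proj₂ (proj₂ labels) l leaf-l
    ... | x , refl = attached-inside-bridge⇒uncovered τ vst v≢s v≢t x
                       (distinct-first-steps⇒∈p v→l v→s u≢u₁) (distinct-first-steps⇒∈p v→l v→t u≢u₂) (covering x)
    only-two : ∀ u → Adj v u → u ≡ u₁ ⊎ u ≡ u₂
    only-two u vu with u ≟ u₁ | u ≟ u₂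
    ... | yes u≡u₁ | _ = inj₁ u≡u₁
    ... | no _ | yes u≡u₂ = inj₂ u≡u₂
    ... | no u≢u₁ | no u≢u₂ = ⊥-elim (no-third-neighbour u vu u≢u₁ u≢u₂)

  FourPoint : Set
  FourPoint = (S a b + S c d < S a c + S b d) × (S a c + S b d ≈ S a d + S b c)

  Split∧BridgeOneEdge⇒FourPoint∧Covering : Split a b c d × BridgeOneEdge a b c d → FourPoint × Covering
  Split∧BridgeOneEdge⇒FourPoint∧Covering (split , bridge) with Split⇒Resolved split
  ... | s , t , τ =
    ( <-respʳ-≈ (≈-sym (proj₁ (four-point-resolved τ))) (x<x+y (Resolved⇒0<2D τ A≢B A≢C B≢C C≢D A≢D))
    , ≈-sym (proj₂ (four-point-resolved τ)) )
    , one-edge-bridge⇒Covering τ (BridgeOneEdge⇒length≡2 τ bridge)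

  FourPoint∧Covering⇒Split∧BridgeOneEdge : FourPoint × Covering → Split a b c d × BridgeOneEdge a b c d
  FourPoint∧Covering⇒Split∧BridgeOneEdge ((ab+cd<ac+bd , ac+bd≈ad+bc) , covering) with shape (leaf a) (leaf b) (leaf c) (leaf d)
  ... | star s σ = ⊥-elim (irrefl (≈-sym (proj₁ (four-point-star σ))) ab+cd<ac+bd)
  ... | ab∣cd s t τ with length (p s t) ℕ.≟ 2
  ...   | yes length≡2 = Resolved⇒Split τ , length≡2⇒BridgeOneEdge τ length≡2
  ...   | no length≢2 = ⊥-elim (long-bridge⇒¬Covering τ length≢2 covering)
  FourPoint∧Covering⇒Split∧BridgeOneEdge ((ab+cd<ac+bd , _) , _) | ac∣bd s t τ =
    ⊥-elim (<-asym ab+cd<ac+bd (<-respʳ-≈ (≈-sym (proj₁ (four-point-resolved τ)))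
                                           (x<x+y (Resolved⇒0<2D τ A≢C A≢B (≢-sym B≢C) B≢D A≢D))))
  FourPoint∧Covering⇒Split∧BridgeOneEdge ((_ , ac+bd≈ad+bc) , _) | ad∣bc s t τ =
    ⊥-elim (x≈y+z⇒x≉y (Resolved⇒0<2D τ A≢D A≢B (≢-sym B≢D) B≢C A≢C) ad+bc≈ad+bc+2D ≈-refl)
    where
    ad+bc≈ad+bc+2D : S a d + S b c ≈ (S a d + S b c) + (D s t + D s t)
    ad+bc≈ad+bc+2D = ≈-trans (≈-sym ac+bd≈ad+bc)
      (≈-trans (+-congˡ (D-sym (leaf b) (leaf d))) (≈-trans (proj₂ (four-point-resolved τ)) (proj₁ (four-point-resolved τ))))

proposition3p3 : (ℝ : RealField) {m n : ℕ} (T : WTree ℝ m) (leaf : Fin n → Fin m) →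
    TreeDefs.InternalPositive T → TreeDefs.Essential T → LeafDefs.LeafSet T leaf →
    (a b c d : Fin n) →
    a ≢ b → a ≢ c → a ≢ d → b ≢ c → b ≢ d → c ≢ d →
    (LeafDefs.Split T leaf a b c d →
      (∀ x → (LeafDefs.InL T leaf a b c d x × x ≢ a × x ≢ b) ⇔
             ((x ≢ a × x ≢ b × x ≢ c × x ≢ d) × LeafDefs.Clings T leaf a b c d x)) ×
      (∀ x → (LeafDefs.InL T leaf c d a b x × x ≢ c × x ≢ d) ⇔
             ((x ≢ a × x ≢ b × x ≢ c × x ≢ d) × LeafDefs.Clings T leaf c d a b x))) ×
    ((LeafDefs.Split T leaf a b c d × LeafDefs.BridgeOneEdge T leaf a b c d) ⇔
     ((RealField._<_ ℝ (RealField._+_ ℝ (LeafDefs.S T leaf a b) (LeafDefs.S T leaf c d))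
                       (RealField._+_ ℝ (LeafDefs.S T leaf a c) (LeafDefs.S T leaf b d)) ×
       RealField._≈_ ℝ (RealField._+_ ℝ (LeafDefs.S T leaf a c) (LeafDefs.S T leaf b d))
                       (RealField._+_ ℝ (LeafDefs.S T leaf a d) (LeafDefs.S T leaf b c))) ×
      (∀ x → LeafDefs.InL T leaf a b c d x ⊎ LeafDefs.InL T leaf c d a b x)))
proposition3p3 ℝ T leaf internal-positive essential labels a b c d a≢b a≢c a≢d b≢c b≢d c≢d =
  L-characterisations , mk⇔ Split∧BridgeOneEdge⇒FourPoint∧Covering FourPoint∧Covering⇒Split∧BridgeOneEdge
  where open Proposition T leaf essential internal-positive labels a b c d a≢b a≢c a≢d b≢c b≢d c≢d
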